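{- Let $p>2$ be a prime and let $\alpha\in\mathbb{Q}_p$ be a quadratic irrational over $\mathbb{Q}$, written as $\alpha=\frac{b_0+\delta}{p^{k_0}c_0}$ with $b_0,c_0,k_0\in\mathbb{Z}$, $p\nmid c_0$, $\delta\in\mathbb{Q}_p$, $\delta^2=\Delta$ a non-square integer, $c_0\mid\Delta-b_0^2$. Let $\alpha_n$ be the Browkin complete quotients of $\alpha$, and for $n>0$ let $\xi_n$ be the image of $\alpha_n$ under an embedding of $\mathbb{Q}(\delta)$ into $\mathbb{C}$, with norm $N(\xi_n)$ (product of the two complex images of $\alpha_n$). Suppose $\Delta>0$, put $t=\lfloor\sqrt{\Delta}\rfloor$ and $K=(2t+1)\Delta+1-\frac{t(t+1)(2t+1)}{3}$. If there exists $n_0>0$ such that $N(\xi_n)<0$ for every integer $n\in[n_0,n_0+K]$, then the Browkin continued fraction expansion of $\alpha$ is periodic, with period of length at most $K$.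
   Context: Let $\mathcal{Y}=\mathbb{Z}[1/p]\cap(-p/2,p/2)$; for $\gamma\in\mathbb{Q}_p$, $s(\gamma)$ is the unique element of $\mathcal{Y}$ with $|\gamma-s(\gamma)|_p<1$. The Browkin continued fraction of $\alpha$ is obtained by $\alpha_0=\alpha$, $a_n=s(\alpha_n)$, $\alpha_{n+1}=1/(\alpha_n-a_n)$; the $\alpha_n$ are the complete quotients. Periodic means there are $M_0\ge0$, $h>0$ with $a_{m+h}=a_m$ for all $m\ge M_0$; the period length is the corresponding $h$. -}

module Defs where

open import Data.Nat as ℕ using (ℕ; zero; suc)
open import Data.Integer as ℤ using (ℤ; +_; -[1+_])
open import Data.Integer.Divisibility using () renaming (_∣_ to _∣ℤ_)
open import Data.Rational as ℚ using (ℚ; _/_; 0ℚ; 1ℚ)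
open import Data.Product using (Σ; _×_; _,_; ∃)
open import Relation.Binary.PropositionalEquality using (_≡_)
open import Relation.Nullary using (¬_)

ι : ℤ → ℚ
ι z = z / 1

-- Elements of ℚ(δ) ⊂ ℚₚ, written x + y·δ with x y ∈ ℚ (δ² = Δ, Δ a non-square,
-- so the representation is unique).
Qδ : Set
Qδ = ℚ × ℚ

scal : ℚ → Qδ
scal c = c , 0ℚ

_⊖_ : Qδ → Qδ → Qδ
(x₁ , y₁) ⊖ (x₂ , y₂) = (x₁ ℚ.- x₂) , (y₁ ℚ.- y₂)

-- multiplication in ℚ(δ), using δ² = Δ
mulδ : ℤ → Qδ → Qδ → Qδ
mulδ Δ (x₁ , y₁) (x₂ , y₂) =
  (x₁ ℚ.* x₂ ℚ.+ ι Δ ℚ.* (y₁ ℚ.* y₂)) , (x₁ ℚ.* y₂ ℚ.+ y₁ ℚ.* x₂)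

-- Norm: the product of the two complex images of x + yδ under the two
-- embeddings ℚ(δ) → ℂ (δ ↦ ±√Δ), i.e. (x + y√Δ)(x − y√Δ) = x² − Δ y².
normδ : ℤ → Qδ → ℚ
normδ Δ (x , y) = x ℚ.* x ℚ.- ι Δ ℚ.* (y ℚ.* y)

-- δ ∈ ℤₚ with δ² = Δ, given as a coherent sequence of approximations:
-- d k ≡ δ (mod pᵏ).
IsPAdicSqrt : ℕ → ℤ → (ℕ → ℤ) → Set
IsPAdicSqrt p Δ d =
  (∀ k → (+ (p ℕ.^ k)) ∣ℤ (d k ℤ.* d k ℤ.- Δ)) ×
  (∀ k → (+ (p ℕ.^ k)) ∣ℤ (d (suc k) ℤ.- d k))

-- |γ|ₚ < 1 for γ = x + yδ ∈ ℚₚ (δ given by d as above):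
-- γ = (u + vδ)/(w pᵐ) with p ∤ w and u + vδ ≡ 0 (mod p^(m+1)) in ℤₚ,
-- i.e. p^(m+1) ∣ u + v·d(m+1).
PAdicSmall : ℕ → (ℕ → ℤ) → Qδ → Set
PAdicSmall p d (x , y) =
  Σ ℤ λ u → Σ ℤ λ v → Σ ℕ λ w → Σ ℕ λ m →
    ¬ ((+ p) ∣ℤ (+ w)) ×
    (x ℚ.* ι (+ (w ℕ.* p ℕ.^ m)) ≡ ι u) ×
    (y ℚ.* ι (+ (w ℕ.* p ℕ.^ m)) ≡ ι v) ×
    ((+ (p ℕ.^ suc m)) ∣ℤ (u ℤ.+ v ℤ.* d (suc m)))

InY : ℕ → ℚ → Set
InY p c =
  (∃ λ k → ∃ λ z → c ℚ.* ι (+ (p ℕ.^ k)) ≡ ι z) ×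
  (ℚ.- ι (+ p) ℚ.< ι (+ 2) ℚ.* c) × (ι (+ 2) ℚ.* c ℚ.< ι (+ p))

-- c = s(γ): c ∈ 𝒴 and |γ − c|ₚ < 1  (such c is unique)
IsS : ℕ → (ℕ → ℤ) → Qδ → ℚ → Set
IsS p d γ c = InY p c × PAdicSmall p d (γ ⊖ scal c)

IsBrowkin : ℕ → ℤ → (ℕ → ℤ) → Qδ → (ℕ → Qδ) → (ℕ → ℚ) → Set
IsBrowkin p Δ d α₀ α a =
  (α 0 ≡ α₀) ×
  (∀ n → IsS p d (α n) (a n)) ×
  (∀ n → mulδ Δ (α (suc n)) (α n ⊖ scal (a n)) ≡ scal 1ℚ)

-- α = (b₀ + δ)/(pᵏ⁰ c₀) for k₀ ∈ ℤ, stated by clearing denominators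
-- (c₀ ≠ 0 and p ≠ 0, so this determines α):
--   k₀ = n ≥ 0  :  pⁿ c₀ · α = b₀ + δ
--   k₀ = −(n+1) :  c₀ · α = p^(n+1) (b₀ + δ)
IsAlphaForm : ℕ → ℤ → Qδ → ℤ → ℤ → ℤ → Set
IsAlphaForm p Δ α b₀ c₀ (+ n) =
  mulδ Δ (scal (ι (+ (p ℕ.^ n) ℤ.* c₀))) α ≡ (ι b₀ , 1ℚ)
IsAlphaForm p Δ α b₀ c₀ -[1+ n ] =
  mulδ Δ (scal (ι c₀)) α ≡ mulδ Δ (scal (ι (+ (p ℕ.^ suc n)))) (ι b₀ , 1ℚ)

Kconst : ℕ → ℤ → ℤ
Kconst t Δ = (+ (2 ℕ.* t ℕ.+ 1)) ℤ.* Δ ℤ.+ + 1 ℤ.- + ((t ℕ.* (t ℕ.+ 1) ℕ.* (2 ℕ.* t ℕ.+ 1)) ℕ./ 3)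

{-# OPTIONS --safe #-}
-- Write the complete quotients as αₙ = (Pₙ + δ)/Qₙ. Since aₙ = s(αₙ) is p-adically close to αₙ,
-- the next numerator Pₙ₊₁ = aₙQₙ − Pₙ is an integer, and Qₙ divides Δ − Pₙ₊₁²: it divides
-- w(Δ − Pₙ₊₁²) for some p ∤ w by the p-adic smallness of αₙ − aₙ, and pᴺ(Δ − Pₙ₊₁²) after clearing the
-- p-power denominator of aₙ. Hence QₙQₙ₊₁ = Δ − Pₙ₊₁² with Qₙ₊₁ ∈ ℤ.
-- As N(αₙ) = (Pₙ² − Δ)/Qₙ², a negative norm means Qₙ₋₁Qₙ = Δ − Pₙ² > 0, so |Pₙ| ≤ t,
-- 1 ≤ |Qₙ| ≤ Δ − Pₙ², and Qₙ keeps its sign through the window. There are only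
-- Σ_{|P| ≤ t} (Δ − P²) = K − 1 such pairs (Pₙ, |Qₙ|), so two of K consecutive complete quotients
-- coincide; as αₙ determines the rest of the expansion, it is periodic with period at most K.
module Submission where

open import Defs
open import Data.Nat as ℕ using (ℕ; zero; suc; _∸_)
import Data.Nat.Properties as ℕP
import Data.Nat.Divisibility as ℕD
import Data.Nat.DivMod as ℕDM
open import Data.Nat.Coprimality using (Coprime; coprime-divisor; coprime-factors)
open import Data.Nat.Primality using (Prime; prime⇒irreducible; prime⇒nonZero; euclidsLemma)
open import Data.Integer as ℤ using (ℤ; +_; -[1+_]; +[1+_])
import Data.Integer.Properties as ℤP
open import Data.Integer.GCD using (gcd-zeroʳ)
open import Data.Integer.Divisibility using () renaming (_∣_ to _∣ℤ_)
open import Data.Integer.Divisibility.Signed as ℤD using (_∣_; divides; ∣ᵤ⇒∣; ∣⇒∣ᵤ)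
open import Data.Rational as ℚ using (ℚ; mkℚ; 0ℚ; 1ℚ; ↥_; ↧_; ↧ₙ_)
import Data.Rational.Properties as ℚP
open import Data.Fin using (Fin; toℕ)
import Data.Fin.Properties as FinP
open import Data.List using (List; _++_; map; upTo; length; lookup)
import Data.List.Properties as LP
open import Data.List.Membership.Propositional using (_∈_)
open import Data.List.Membership.Propositional.Properties using (∈-map⁺; ∈-++⁺ˡ; ∈-++⁺ʳ; ∈-upTo⁺)
open import Data.List.Relation.Unary.Any using (index)
open import Data.List.Relation.Unary.Any.Properties using (lookup-index)
open import Data.Product using (Σ; _×_; _,_; proj₁; proj₂)
open import Data.Sum using (inj₁; inj₂; [_,_]′)
open import Data.Empty using (⊥-elim)
open import Relation.Nullary using (¬_)
open import Relation.Binary.PropositionalEquality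
import Data.Nat.Tactic.RingSolver as ℕSolver
import Data.Integer.Tactic.RingSolver as ℤSolver
open import Data.Rational.Solver using (module +-*-Solver)
open +-*-Solver

↥-ι : ∀ z → ↥ ι z ≡ z
↥-ι z = trans (sym (ℤP.*-identityʳ _)) (trans (cong (↥ ι z ℤ.*_) (sym (gcd-zeroʳ z))) (ℚP.↥-/ z 1))

↧-ι : ∀ z → ↧ ι z ≡ + 1
↧-ι z = trans (sym (ℤP.*-identityʳ _)) (trans (cong (↧ ι z ℤ.*_) (sym (gcd-zeroʳ z))) (ℚP.↧-/ z 1))

ι-injective : ∀ {a b} → ι a ≡ ι b → a ≡ b
ι-injective {a} {b} e = trans (sym (↥-ι a)) (trans (cong ↥_ e) (↥-ι b))

-- ι z is not definitionally of the form mkℚ z 0 _, but it is propositionally,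
-- and in that form the operations of ℚ compute.
data Integral : ℚ → ℤ → Set where
  integral : ∀ z .(c : Coprime ℤ.∣ z ∣ 1) → Integral (mkℚ z 0 c) z

integral-ι : ∀ z → Integral (ι z) z
integral-ι z = view (ι z) (↥-ι z) (ℤP.+-injective (↧-ι z))
  where
  view : ∀ q → ↥ q ≡ z → ↧ₙ q ≡ 1 → Integral q z
  view (mkℚ _ zero _) refl refl = integral _ _

ι-homo-* : ∀ a b → ι (a ℤ.* b) ≡ ι a ℚ.* ι b
ι-homo-* a b with ι a | integral-ι a | ι b | integral-ι b
... | _ | integral _ _ | _ | integral _ _ = refl

ι-homo-+ : ∀ a b → ι (a ℤ.+ b) ≡ ι a ℚ.+ ι b
ι-homo-+ a b with ι a | integral-ι a | ι b | integral-ι b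
... | _ | integral _ _ | _ | integral _ _ =
  ℚP./-cong (sym (cong₂ ℤ._+_ (ℤP.*-identityʳ a) (ℤP.*-identityʳ b))) refl

ι-homo-neg : ∀ a → ι (ℤ.- a) ≡ ℚ.- ι a
ι-homo-neg a with ι a | integral-ι a
... | q | integral _ _ =
  trans (ℚP./-cong (sym (ℚP.↥-neg q)) (sym (ℤP.+-injective (ℚP.↧-neg q)))) (ℚP.↥p/↧p≡p (ℚ.- q))

ι-homo-‿- : ∀ a b → ι (a ℤ.- b) ≡ ι a ℚ.- ι b
ι-homo-‿- a b = trans (ι-homo-+ a (ℤ.- b)) (cong (ι a ℚ.+_) (ι-homo-neg b))

ι-cross : ∀ a b → ↥ ι a ℤ.* ↧ ι b ≡ a
ι-cross a b = trans (cong₂ ℤ._*_ (↥-ι a) (↧-ι b)) (ℤP.*-identityʳ a)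

ι-mono-< : ∀ {a b} → a ℤ.< b → ι a ℚ.< ι b
ι-mono-< {a} {b} a<b = ℚ.*<* (subst₂ ℤ._<_ (sym (ι-cross a b)) (sym (ι-cross b a)) a<b)

ι-cancel-< : ∀ {a b} → ι a ℚ.< ι b → a ℤ.< b
ι-cancel-< {a} {b} (ℚ.*<* lt) = subst₂ ℤ._<_ (ι-cross a b) (ι-cross b a) lt

ι-positive : ∀ {z} → + 0 ℤ.< z → ℚ.Positive (ι z)
ι-positive h = ℚ.positive (ι-mono-< h)

ι-≢0 : ∀ {z} → z ≢ + 0 → ι z ≢ 0ℚ
ι-≢0 z≢0 e = z≢0 (ι-injective e)

*-cancelʳ-≡ : ∀ a b q → q ≢ 0ℚ → a ℚ.* q ≡ b ℚ.* q → a ≡ b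
*-cancelʳ-≡ a b q q≢0 e = begin
  a                      ≡⟨ sym (ℚP.*-identityʳ a) ⟩
  a ℚ.* 1ℚ               ≡⟨ cong (a ℚ.*_) (sym (ℚP.*-inverseʳ q)) ⟩
  a ℚ.* (q ℚ.* ℚ.1/ q)   ≡⟨ sym (ℚP.*-assoc a q _) ⟩
  (a ℚ.* q) ℚ.* ℚ.1/ q   ≡⟨ cong (ℚ._* ℚ.1/ q) e ⟩
  (b ℚ.* q) ℚ.* ℚ.1/ q   ≡⟨ ℚP.*-assoc b q _ ⟩
  b ℚ.* (q ℚ.* ℚ.1/ q)   ≡⟨ cong (b ℚ.*_) (ℚP.*-inverseʳ q) ⟩
  b ℚ.* 1ℚ               ≡⟨ ℚP.*-identityʳ b ⟩
  b                      ∎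
  where
  open ≡-Reasoning
  instance _ = ℚ.≢-nonZero q≢0

p-q≡0⇒p≡q : ∀ p q → p ℚ.- q ≡ 0ℚ → p ≡ q
p-q≡0⇒p≡q p q e = begin
  p                 ≡⟨ solve 2 (λ p q → p := (p :- q) :+ q) refl p q ⟩
  (p ℚ.- q) ℚ.+ q   ≡⟨ cong (ℚ._+ q) e ⟩
  0ℚ ℚ.+ q          ≡⟨ ℚP.+-identityˡ q ⟩
  q                 ∎
  where open ≡-Reasoning

coprime-of-∤ : ∀ {p n} → Prime p → ¬ p ℕD.∣ n → Coprime p n
coprime-of-∤ pp p∤n (d∣p , d∣n) with prime⇒irreducible pp d∣p
... | inj₁ d≡1 = d≡1
... | inj₂ refl = ⊥-elim (p∤n d∣n)

^-∣-coprime-cancel : ∀ {p w} → Prime p → ¬ p ℕD.∣ w → ∀ j {x} → p ℕ.^ j ℕD.∣ w ℕ.* x → p ℕ.^ j ℕD.∣ x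
^-∣-coprime-cancel pp p∤w zero _ = ℕD.1∣ _
^-∣-coprime-cancel {p} {w} pp p∤w (suc j) {x} h
  with coprime-divisor (coprime-of-∤ pp p∤w) (ℕD.∣-trans (ℕD.m∣m*n (p ℕ.^ j)) h)
... | ℕD.divides x′ refl = subst (ℕD._∣ x′ ℕ.* p) (ℕP.*-comm (p ℕ.^ j) p) (ℕD.*-monoˡ-∣ p p^j∣x′)
  where
  instance _ = prime⇒nonZero pp
  p^j∣x′ : p ℕ.^ j ℕD.∣ x′
  p^j∣x′ = ^-∣-coprime-cancel pp p∤w j (ℕD.*-cancelˡ-∣ p (subst (p ℕ.^ suc j ℕD.∣_) (reorder w x′ p) h))
    where
    reorder : ∀ w x p → w ℕ.* (x ℕ.* p) ≡ p ℕ.* (w ℕ.* x)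
    reorder w x p = trans (sym (ℕP.*-assoc w x p)) (ℕP.*-comm (w ℕ.* x) p)

∣-^-coprime-cancel : ∀ {p w} → Prime p → ¬ p ℕD.∣ w → ∀ N {q g} → q ℕD.∣ w ℕ.* g → q ℕD.∣ p ℕ.^ N ℕ.* g → q ℕD.∣ g
∣-^-coprime-cancel pp p∤w zero {q} {g} _ h = subst (q ℕD.∣_) (ℕP.*-identityˡ g) h
∣-^-coprime-cancel {p} {w} pp p∤w (suc N) {q} {g} q∣wg h =
  ∣-^-coprime-cancel pp p∤w N q∣wg (coprime-factors (coprime-of-∤ pp p∤w) (q∣p*p^Ng , q∣w*p^Ng))
  where
  q∣p*p^Ng : q ℕD.∣ p ℕ.* (p ℕ.^ N ℕ.* g)
  q∣p*p^Ng = subst (q ℕD.∣_) (ℕP.*-assoc p (p ℕ.^ N) g) h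
  q∣w*p^Ng : q ℕD.∣ w ℕ.* (p ℕ.^ N ℕ.* g)
  q∣w*p^Ng = subst (q ℕD.∣_) (swap (p ℕ.^ N) w g) (ℕD.∣n⇒∣m*n (p ℕ.^ N) q∣wg)
    where
    swap : ∀ a b c → a ℕ.* (b ℕ.* c) ≡ b ℕ.* (a ℕ.* c)
    swap = ℕSolver.solve-∀

^-∣ℤ-coprime-cancel : ∀ {p w} → Prime p → ¬ p ℕD.∣ ℤ.∣ w ∣ → ∀ j {X} → + (p ℕ.^ j) ∣ w ℤ.* X → + (p ℕ.^ j) ∣ X
^-∣ℤ-coprime-cancel {w = w} pp p∤w j {X} h =
  ∣ᵤ⇒∣ (^-∣-coprime-cancel pp p∤w j (subst (_ ℕD.∣_) (ℤP.abs-* w X) (∣⇒∣ᵤ h)))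

∣ℤ-^-coprime-cancel : ∀ {p w} → Prime p → ¬ p ℕD.∣ ℤ.∣ w ∣ → ∀ N {Q G} → Q ∣ w ℤ.* G → Q ∣ + (p ℕ.^ N) ℤ.* G → Q ∣ G
∣ℤ-^-coprime-cancel {p} {w} pp p∤w N {Q} {G} h h′ =
  ∣ᵤ⇒∣ (∣-^-coprime-cancel pp p∤w N (subst (_ ℕD.∣_) (ℤP.abs-* w G) (∣⇒∣ᵤ h))
                                     (subst (_ ℕD.∣_) (ℤP.abs-* (+ (p ℕ.^ N)) G) (∣⇒∣ᵤ h′)))

*-≢0 : ∀ {a b} → a ≢ + 0 → b ≢ + 0 → a ℤ.* b ≢ + 0
*-≢0 {a} a≢0 b≢0 ab≡0 = [ a≢0 , b≢0 ]′ (ℤP.i*j≡0⇒i≡0∨j≡0 a ab≡0)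

∤⇒≢0 : ∀ {p c} → ¬ (+ p ∣ℤ c) → c ≢ + 0
∤⇒≢0 {p} p∤c refl = p∤c (ℕD._∣0 p)

-i*-i≡i*i : ∀ i → ℤ.- i ℤ.* ℤ.- i ≡ i ℤ.* i
-i*-i≡i*i = ℤSolver.solve-∀

sign-witness : ∀ c → Σ ℤ λ s → s ℤ.* c ≡ + ℤ.∣ c ∣
sign-witness (+ n) = + 1 , ℤP.*-identityˡ (+ n)
sign-witness -[1+ n ] = ℤ.- + 1 , ℤP.-1*i≡-i -[1+ n ]

∣∧bounded⇒≡0 : ∀ {X Z} → + 0 ℤ.< X → X ∣ Z → ℤ.- X ℤ.< Z → Z ℤ.< X → Z ≡ + 0
∣∧bounded⇒≡0 {X} X>0 (divides ζ refl) lower upper =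
  trans (cong (ℤ._* X) (between ζ>-1 ζ<1)) (ℤP.*-zeroˡ X)
  where
  instance _ = ℤ.nonNegative (ℤP.<⇒≤ X>0)
  ζ>-1 : ℤ.-1ℤ ℤ.< ζ
  ζ>-1 = ℤP.*-cancelʳ-<-nonNeg X (subst (ℤ._< ζ ℤ.* X) (sym (ℤP.-1*i≡-i X)) lower)
  ζ<1 : ζ ℤ.< ℤ.1ℤ
  ζ<1 = ℤP.*-cancelʳ-<-nonNeg X (subst (ζ ℤ.* X ℤ.<_) (sym (ℤP.*-identityˡ X)) upper)
  between : ∀ {z} → ℤ.-1ℤ ℤ.< z → z ℤ.< ℤ.1ℤ → z ≡ + 0
  between {+ zero} _ _ = refl
  between {+ suc _} _ (ℤ.+<+ (ℕ.s≤s ()))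
  between { -[1+ _ ]} (ℤ.-<- ()) _

cross-difference-bound : ∀ A B a b P → + 0 ℤ.< a → + 0 ℤ.< b →
  ℤ.- (P ℤ.* a) ℤ.< A → A ℤ.< P ℤ.* a → ℤ.- (P ℤ.* b) ℤ.< B → B ℤ.< P ℤ.* b →
  (ℤ.- (P ℤ.* a ℤ.* b ℤ.+ P ℤ.* a ℤ.* b) ℤ.< A ℤ.* b ℤ.- B ℤ.* a) × (A ℤ.* b ℤ.- B ℤ.* a ℤ.< P ℤ.* a ℤ.* b ℤ.+ P ℤ.* a ℤ.* b)
cross-difference-bound A B a b P a>0 b>0 A> A< B> B< =
  subst (ℤ._< A ℤ.* b ℤ.- B ℤ.* a) (neg-double (P ℤ.* a ℤ.* b))
    (ℤP.+-mono-< (subst (ℤ._< A ℤ.* b) (neg-left P a b) (ℤP.*-monoʳ-<-pos b A>))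
                 (subst (ℤ._< ℤ.- (B ℤ.* a)) (neg-swap P a b) (ℤP.neg-mono-< (ℤP.*-monoʳ-<-pos a B<)))) ,
  ℤP.+-mono-< (ℤP.*-monoʳ-<-pos b A<)
              (subst₂ ℤ._<_ (neg-right B a) (neg-neg P a b) (ℤP.*-monoʳ-<-pos a (ℤP.neg-mono-< B>)))
  where
  instance _ = ℤ.positive a>0
           _ = ℤ.positive b>0
  neg-double : ∀ x → ℤ.- x ℤ.+ ℤ.- x ≡ ℤ.- (x ℤ.+ x)
  neg-double = ℤSolver.solve-∀
  neg-left : ∀ P a b → ℤ.- (P ℤ.* a) ℤ.* b ≡ ℤ.- (P ℤ.* a ℤ.* b)
  neg-left = ℤSolver.solve-∀
  neg-swap : ∀ P a b → ℤ.- (P ℤ.* b ℤ.* a) ≡ ℤ.- (P ℤ.* a ℤ.* b)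
  neg-swap = ℤSolver.solve-∀
  neg-right : ∀ B a → ℤ.- B ℤ.* a ≡ ℤ.- (B ℤ.* a)
  neg-right = ℤSolver.solve-∀
  neg-neg : ∀ P a b → ℤ.- ℤ.- (P ℤ.* b) ℤ.* a ≡ P ℤ.* a ℤ.* b
  neg-neg = ℤSolver.solve-∀

-- p-adic smallness and uniqueness of s(γ)

_^⁺_ : ℕ → ℕ → ℤ
p ^⁺ n = + (p ℕ.^ n)

^⁺-suc : ∀ p n → p ^⁺ suc n ≡ + p ℤ.* p ^⁺ n
^⁺-suc p n = ℤP.pos-* p (p ℕ.^ n)

^⁺-+ : ∀ p m n → p ^⁺ (m ℕ.+ n) ≡ p ^⁺ m ℤ.* p ^⁺ n
^⁺-+ p m n = trans (cong +_ (ℕP.^-distribˡ-+-* p m n)) (ℤP.pos-* (p ℕ.^ m) (p ℕ.^ n))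

^⁺-positive : ∀ {p} → Prime p → ∀ n → + 0 ℤ.< p ^⁺ n
^⁺-positive pp n = ℤ.+<+ (ℕP.m^n>0 _ n)
  where instance _ = prime⇒nonZero pp

^⁺-≢0 : ∀ {p} → Prime p → ∀ n → p ^⁺ n ≢ + 0
^⁺-≢0 pp n e = ℤP.<-irrefl (sym e) (^⁺-positive pp n)

^⁺-∣-+ : ∀ p m n {X} → p ^⁺ (n ℕ.+ m) ∣ X → p ^⁺ m ∣ X
^⁺-∣-+ p m n = ℤD.∣-trans (divides (p ^⁺ n) (^⁺-+ p n m))

IsPAdicSqrt⇒coherent : ∀ {p Δ d} → IsPAdicSqrt p Δ d → ∀ i k → p ^⁺ i ∣ d (k ℕ.+ i) ℤ.- d i
IsPAdicSqrt⇒coherent {d = d} H i zero = divides (+ 0) (ℤP.+-inverseʳ (d i))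
IsPAdicSqrt⇒coherent {p} {Δ} {d} H i (suc k) =
  subst (p ^⁺ i ∣_) (telescope (d (suc k ℕ.+ i)) (d (k ℕ.+ i)) (d i))
    (ℤD.∣m∣n⇒∣m+n step (IsPAdicSqrt⇒coherent {p} {Δ} {d} H i k))
  where
  step : p ^⁺ i ∣ d (suc k ℕ.+ i) ℤ.- d (k ℕ.+ i)
  step = ^⁺-∣-+ p i k (∣ᵤ⇒∣ (proj₂ H (k ℕ.+ i)))
  telescope : ∀ a b c → (a ℤ.- b) ℤ.+ (b ℤ.- c) ≡ a ℤ.- c
  telescope = ℤSolver.solve-∀

ι-homo-*-‿-* : ∀ a b c e → ι (a ℤ.* b ℤ.- c ℤ.* e) ≡ ι a ℚ.* ι b ℚ.- ι c ℚ.* ι e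
ι-homo-*-‿-* a b c e = trans (ι-homo-‿- (a ℤ.* b) (c ℤ.* e)) (cong₂ ℚ._-_ (ι-homo-* a b) (ι-homo-* c e))

sub-scaled : ∀ x x′ A B a b → x ℚ.* A ≡ a → x′ ℚ.* B ≡ b → (x ℚ.- x′) ℚ.* (A ℚ.* B) ≡ a ℚ.* B ℚ.- b ℚ.* A
sub-scaled x x′ A B _ _ refl refl =
  solve 4 (λ x x′ A B → (x :- x′) :* (A :* B) := (x :* A) :* B :- (x′ :* B) :* A) refl x x′ A B

InY-numerator-bounds : ∀ {p c k z} → + 0 ℤ.< p ^⁺ k → c ℚ.* ι (p ^⁺ k) ≡ ι z →
  ℚ.- ι (+ p) ℚ.< ι (+ 2) ℚ.* c → ι (+ 2) ℚ.* c ℚ.< ι (+ p) →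
  (ℤ.- (+ p ℤ.* p ^⁺ k) ℤ.< + 2 ℤ.* z) × (+ 2 ℤ.* z ℤ.< + p ℤ.* p ^⁺ k)
InY-numerator-bounds {p} {c} {k} {z} p^k>0 cz lower upper =
  ι-cancel-< (subst₂ ℚ._<_ -pP 2z (ℚP.*-monoˡ-<-pos (ι (p ^⁺ k)) lower)) ,
  ι-cancel-< (subst₂ ℚ._<_ 2z pP (ℚP.*-monoˡ-<-pos (ι (p ^⁺ k)) upper))
  where
  instance _ = ι-positive p^k>0
  pP : ι (+ p) ℚ.* ι (p ^⁺ k) ≡ ι (+ p ℤ.* p ^⁺ k)
  pP = sym (ι-homo-* (+ p) (p ^⁺ k))
  -pP : ℚ.- ι (+ p) ℚ.* ι (p ^⁺ k) ≡ ι (ℤ.- (+ p ℤ.* p ^⁺ k))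
  -pP = trans (sym (ℚP.neg-distribˡ-* (ι (+ p)) (ι (p ^⁺ k))))
              (trans (cong ℚ.-_ pP) (sym (ι-homo-neg (+ p ℤ.* p ^⁺ k))))
  2z : ι (+ 2) ℚ.* c ℚ.* ι (p ^⁺ k) ≡ ι (+ 2 ℤ.* z)
  2z = trans (ℚP.*-assoc (ι (+ 2)) c (ι (p ^⁺ k))) (trans (cong (ι (+ 2) ℚ.*_) cz) (sym (ι-homo-* (+ 2) z)))

InY-cross-bounds : ∀ {p c c′ k k′ z z′} → Prime p → c ℚ.* ι (p ^⁺ k) ≡ ι z → c′ ℚ.* ι (p ^⁺ k′) ≡ ι z′ →
  ℚ.- ι (+ p) ℚ.< ι (+ 2) ℚ.* c → ι (+ 2) ℚ.* c ℚ.< ι (+ p) →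
  ℚ.- ι (+ p) ℚ.< ι (+ 2) ℚ.* c′ → ι (+ 2) ℚ.* c′ ℚ.< ι (+ p) →
  (ℤ.- (+ p ℤ.* (p ^⁺ k ℤ.* p ^⁺ k′)) ℤ.< z ℤ.* p ^⁺ k′ ℤ.- z′ ℤ.* p ^⁺ k) ×
  (z ℤ.* p ^⁺ k′ ℤ.- z′ ℤ.* p ^⁺ k ℤ.< + p ℤ.* (p ^⁺ k ℤ.* p ^⁺ k′))
InY-cross-bounds {p} {c} {c′} {k} {k′} {z} {z′} pp cz cz′ c> c< c′> c′< =
  ℤP.*-cancelˡ-<-nonNeg (+ 2) (subst₂ ℤ._<_ (twice-neg (+ p) a b) (twice z z′ a b) (proj₁ bounds)) ,
  ℤP.*-cancelˡ-<-nonNeg (+ 2) (subst₂ ℤ._<_ (twice z z′ a b) (twice-pos (+ p) a b) (proj₂ bounds))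
  where
  a = p ^⁺ k
  b = p ^⁺ k′
  zb = InY-numerator-bounds {p} {c} {k} {z} (^⁺-positive pp k) cz c> c<
  z′b = InY-numerator-bounds {p} {c′} {k′} {z′} (^⁺-positive pp k′) cz′ c′> c′<
  bounds = cross-difference-bound (+ 2 ℤ.* z) (+ 2 ℤ.* z′) a b (+ p) (^⁺-positive pp k) (^⁺-positive pp k′)
             (proj₁ zb) (proj₂ zb) (proj₁ z′b) (proj₂ z′b)
  twice : ∀ z z′ a b → + 2 ℤ.* z ℤ.* b ℤ.- + 2 ℤ.* z′ ℤ.* a ≡ + 2 ℤ.* (z ℤ.* b ℤ.- z′ ℤ.* a)
  twice = ℤSolver.solve-∀
  twice-pos : ∀ P a b → P ℤ.* a ℤ.* b ℤ.+ P ℤ.* a ℤ.* b ≡ + 2 ℤ.* (P ℤ.* (a ℤ.* b))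
  twice-pos = ℤSolver.solve-∀
  twice-neg : ∀ P a b → ℤ.- (P ℤ.* a ℤ.* b ℤ.+ P ℤ.* a ℤ.* b) ≡ + 2 ℤ.* ℤ.- (P ℤ.* (a ℤ.* b))
  twice-neg = ℤSolver.solve-∀

InY-0ℚ : ∀ {p} → Prime p → InY p 0ℚ
InY-0ℚ {p} pp = (0 , + 0 , ℚP.*-zeroˡ (ι (+ 1))) ,
                subst₂ ℚ._<_ (ι-homo-neg (+ p)) (sym (ℚP.*-zeroʳ (ι (+ 2)))) (ι-mono-< (ℤP.neg-mono-< p>0)) ,
                subst (ℚ._< ι (+ p)) (sym (ℚP.*-zeroʳ (ι (+ 2)))) (ι-mono-< p>0)
  where
  p>0 : + 0 ℤ.< + p
  p>0 = ℤ.+<+ (ℕ.>-nonZero⁻¹ p {{prime⇒nonZero pp}})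

small-denominator : ∀ {y Q v W} → y ℚ.* ι Q ≡ 1ℚ → y ℚ.* ι W ≡ ι v → v ℤ.* Q ≡ W
small-denominator {y} {Q} {v} {W} yQ yW = ι-injective (begin
  ι (v ℤ.* Q)         ≡⟨ ι-homo-* v Q ⟩
  ι v ℚ.* ι Q         ≡⟨ cong (ℚ._* ι Q) (sym yW) ⟩
  y ℚ.* ι W ℚ.* ι Q   ≡⟨ solve 3 (λ y a b → y :* a :* b := (y :* b) :* a) refl y (ι W) (ι Q) ⟩
  (y ℚ.* ι Q) ℚ.* ι W ≡⟨ cong (ℚ._* ι W) yQ ⟩
  1ℚ ℚ.* ι W          ≡⟨ ℚP.*-identityˡ (ι W) ⟩
  ι W                 ∎)
  where open ≡-Reasoning

p^[j+m]∣vX⇒Qp^j∣wX : ∀ {p} → Prime p → ∀ {v Q w m j X} → v ℤ.* Q ≡ + (w ℕ.* p ℕ.^ m) →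
                       p ^⁺ (j ℕ.+ m) ∣ v ℤ.* X → Q ℤ.* p ^⁺ j ∣ + w ℤ.* X
p^[j+m]∣vX⇒Qp^j∣wX {p} pp {v} {Q} {w} {m} {j} {X} vQ≡ (divides c vX≡) =
  divides c (ℤP.*-cancelʳ-≡ _ _ (p ^⁺ m) {{ℤ.≢-nonZero (^⁺-≢0 pp m)}} (begin
    + w ℤ.* X ℤ.* p ^⁺ m                 ≡⟨ regroup₁ (+ w) X (p ^⁺ m) ⟩
    + w ℤ.* p ^⁺ m ℤ.* X                 ≡⟨ cong (ℤ._* X) (trans (sym (ℤP.pos-* w (p ℕ.^ m))) (sym vQ≡)) ⟩
    v ℤ.* Q ℤ.* X                        ≡⟨ regroup₂ v Q X ⟩
    Q ℤ.* (v ℤ.* X)                      ≡⟨ cong (Q ℤ.*_) vX≡ ⟩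
    Q ℤ.* (c ℤ.* p ^⁺ (j ℕ.+ m))         ≡⟨ cong (λ e → Q ℤ.* (c ℤ.* e)) (^⁺-+ p j m) ⟩
    Q ℤ.* (c ℤ.* (p ^⁺ j ℤ.* p ^⁺ m))    ≡⟨ regroup₃ Q c (p ^⁺ j) (p ^⁺ m) ⟩
    c ℤ.* (Q ℤ.* p ^⁺ j) ℤ.* p ^⁺ m      ∎))
  where
  open ≡-Reasoning
  regroup₁ : ∀ w X a → w ℤ.* X ℤ.* a ≡ w ℤ.* a ℤ.* X
  regroup₁ = ℤSolver.solve-∀
  regroup₂ : ∀ v Q X → v ℤ.* Q ℤ.* X ≡ Q ℤ.* (v ℤ.* X)
  regroup₂ = ℤSolver.solve-∀
  regroup₃ : ∀ Q c a b → Q ℤ.* (c ℤ.* (a ℤ.* b)) ≡ c ℤ.* (Q ℤ.* a) ℤ.* b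
  regroup₃ = ℤSolver.solve-∀

module PAdic {p : ℕ} (pp : Prime p) {Δ : ℤ} {d : ℕ → ℤ} (H : IsPAdicSqrt p Δ d) where

  small-lift : ∀ {m u v} → p ^⁺ suc m ∣ u ℤ.+ v ℤ.* d (suc m) → ∀ k → p ^⁺ suc m ∣ u ℤ.+ v ℤ.* d (k ℕ.+ suc m)
  small-lift {m} {u} {v} h k =
    subst (p ^⁺ suc m ∣_) (shift u v (d (suc m)) (d (k ℕ.+ suc m)))
      (ℤD.∣m∣n⇒∣m+n h (ℤD.∣n⇒∣m*n v (IsPAdicSqrt⇒coherent {p} {Δ} {d} H (suc m) k)))
    where
    shift : ∀ u v D D′ → (u ℤ.+ v ℤ.* D) ℤ.+ v ℤ.* (D′ ℤ.- D) ≡ u ℤ.+ v ℤ.* D′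
    shift = ℤSolver.solve-∀

  small-cross-∣ : ∀ {u v w m u′ v′ w′ m′} → p ^⁺ suc m ∣ u ℤ.+ v ℤ.* d (suc m) → p ^⁺ suc m′ ∣ u′ ℤ.+ v′ ℤ.* d (suc m′) →
                  p ^⁺ suc (m ℕ.+ m′) ∣ (u ℤ.* + (w′ ℕ.* p ℕ.^ m′) ℤ.- u′ ℤ.* + (w ℕ.* p ℕ.^ m))
                                        ℤ.+ (v ℤ.* + (w′ ℕ.* p ℕ.^ m′) ℤ.- v′ ℤ.* + (w ℕ.* p ℕ.^ m)) ℤ.* d (suc (m ℕ.+ m′))
  small-cross-∣ {u} {v} {w} {m} {u′} {v′} {w′} {m′} h h′
    with subst (λ j → p ^⁺ suc m ∣ u ℤ.+ v ℤ.* d j) (trans (ℕP.+-suc m′ m) (cong suc (ℕP.+-comm m′ m))) (small-lift {m} {u} {v} h m′)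
       | subst (λ j → p ^⁺ suc m′ ∣ u′ ℤ.+ v′ ℤ.* d j) (ℕP.+-suc m m′) (small-lift {m′} {u′} {v′} h′ m)
  ... | divides q e | divides q′ e′ = divides (q ℤ.* + w′ ℤ.- q′ ℤ.* + w) (begin
    (u ℤ.* W′ ℤ.- u′ ℤ.* W) ℤ.+ (v ℤ.* W′ ℤ.- v′ ℤ.* W) ℤ.* D
      ≡⟨ regroup u v u′ v′ D W W′ ⟩
    (u ℤ.+ v ℤ.* D) ℤ.* W′ ℤ.- (u′ ℤ.+ v′ ℤ.* D) ℤ.* W
      ≡⟨ cong₂ (λ a b → a ℤ.* W′ ℤ.- b ℤ.* W) e e′ ⟩
    q ℤ.* p ^⁺ suc m ℤ.* W′ ℤ.- q′ ℤ.* p ^⁺ suc m′ ℤ.* W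
      ≡⟨ cong₂ (λ a b → q ℤ.* a ℤ.* W′ ℤ.- q′ ℤ.* b ℤ.* W) (^⁺-suc p m) (^⁺-suc p m′) ⟩
    q ℤ.* (+ p ℤ.* p ^⁺ m) ℤ.* W′ ℤ.- q′ ℤ.* (+ p ℤ.* p ^⁺ m′) ℤ.* W
      ≡⟨ cong₂ (λ a b → q ℤ.* (+ p ℤ.* p ^⁺ m) ℤ.* a ℤ.- q′ ℤ.* (+ p ℤ.* p ^⁺ m′) ℤ.* b) (ℤP.pos-* w′ (p ℕ.^ m′)) (ℤP.pos-* w (p ℕ.^ m)) ⟩
    q ℤ.* (+ p ℤ.* p ^⁺ m) ℤ.* (+ w′ ℤ.* p ^⁺ m′) ℤ.- q′ ℤ.* (+ p ℤ.* p ^⁺ m′) ℤ.* (+ w ℤ.* p ^⁺ m)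
      ≡⟨ collect q q′ (+ w) (+ w′) (+ p) (p ^⁺ m) (p ^⁺ m′) ⟩
    (q ℤ.* + w′ ℤ.- q′ ℤ.* + w) ℤ.* (+ p ℤ.* (p ^⁺ m ℤ.* p ^⁺ m′))
      ≡⟨ cong ((q ℤ.* + w′ ℤ.- q′ ℤ.* + w) ℤ.*_) (trans (cong (+ p ℤ.*_) (sym (^⁺-+ p m m′))) (sym (^⁺-suc p (m ℕ.+ m′)))) ⟩
    (q ℤ.* + w′ ℤ.- q′ ℤ.* + w) ℤ.* p ^⁺ suc (m ℕ.+ m′) ∎)
    where
    regroup : ∀ u v u′ v′ D W W′ → (u ℤ.* W′ ℤ.- u′ ℤ.* W) ℤ.+ (v ℤ.* W′ ℤ.- v′ ℤ.* W) ℤ.* D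
                                 ≡ (u ℤ.+ v ℤ.* D) ℤ.* W′ ℤ.- (u′ ℤ.+ v′ ℤ.* D) ℤ.* W
    regroup = ℤSolver.solve-∀
    collect : ∀ q q′ w w′ P a b → q ℤ.* (P ℤ.* a) ℤ.* (w′ ℤ.* b) ℤ.- q′ ℤ.* (P ℤ.* b) ℤ.* (w ℤ.* a)
                                ≡ (q ℤ.* w′ ℤ.- q′ ℤ.* w) ℤ.* (P ℤ.* (a ℤ.* b))
    collect = ℤSolver.solve-∀
    open ≡-Reasoning
    W = + (w ℕ.* p ℕ.^ m)
    W′ = + (w′ ℕ.* p ℕ.^ m′)
    D = d (suc (m ℕ.+ m′))

  PAdicSmall-⊖ : ∀ {γ γ′} → PAdicSmall p d γ → PAdicSmall p d γ′ → PAdicSmall p d (γ ⊖ γ′)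
  PAdicSmall-⊖ {x , y} {x′ , y′} (u , v , w , m , p∤w , ex , ey , dv) (u′ , v′ , w′ , m′ , p∤w′ , ex′ , ey′ , dv′) =
    u ℤ.* W′ ℤ.- u′ ℤ.* W , v ℤ.* W′ ℤ.- v′ ℤ.* W , w ℕ.* w′ , m ℕ.+ m′ , p∤ww′ ,
    scaled x x′ u u′ ex ex′ , scaled y y′ v v′ ey ey′ ,
    ∣⇒∣ᵤ (small-cross-∣ {u} {v} {w} {m} {u′} {v′} {w′} {m′} (∣ᵤ⇒∣ dv) (∣ᵤ⇒∣ dv′))
    where
    open ≡-Reasoning
    W = + (w ℕ.* p ℕ.^ m)
    W′ = + (w′ ℕ.* p ℕ.^ m′)
    p∤ww′ : ¬ p ℕD.∣ w ℕ.* w′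
    p∤ww′ h = [ p∤w , p∤w′ ]′ (euclidsLemma w w′ pp h)
    WW′ : + (w ℕ.* w′ ℕ.* p ℕ.^ (m ℕ.+ m′)) ≡ W ℤ.* W′
    WW′ = trans (cong +_ (trans (cong (w ℕ.* w′ ℕ.*_) (ℕP.^-distribˡ-+-* p m m′)) (regroup w w′ (p ℕ.^ m) (p ℕ.^ m′))))
                (ℤP.pos-* (w ℕ.* p ℕ.^ m) (w′ ℕ.* p ℕ.^ m′))
      where
      regroup : ∀ a b c e → a ℕ.* b ℕ.* (c ℕ.* e) ≡ a ℕ.* c ℕ.* (b ℕ.* e)
      regroup = ℕSolver.solve-∀
    scaled : ∀ s s′ n n′ → s ℚ.* ι W ≡ ι n → s′ ℚ.* ι W′ ≡ ι n′ →
             (s ℚ.- s′) ℚ.* ι (+ (w ℕ.* w′ ℕ.* p ℕ.^ (m ℕ.+ m′))) ≡ ι (n ℤ.* W′ ℤ.- n′ ℤ.* W)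
    scaled s s′ n n′ e e′ = begin
      (s ℚ.- s′) ℚ.* ι (+ (w ℕ.* w′ ℕ.* p ℕ.^ (m ℕ.+ m′))) ≡⟨ cong (λ z → (s ℚ.- s′) ℚ.* ι z) WW′ ⟩
      (s ℚ.- s′) ℚ.* ι (W ℤ.* W′)                          ≡⟨ cong ((s ℚ.- s′) ℚ.*_) (ι-homo-* W W′) ⟩
      (s ℚ.- s′) ℚ.* (ι W ℚ.* ι W′)                        ≡⟨ sub-scaled s s′ (ι W) (ι W′) (ι n) (ι n′) e e′ ⟩
      ι n ℚ.* ι W′ ℚ.- ι n′ ℚ.* ι W                        ≡⟨ sym (ι-homo-*-‿-* n W′ n′ W) ⟩
      ι (n ℤ.* W′ ℤ.- n′ ℤ.* W)                            ∎

  PAdicSmall-rational-∣ : ∀ {r N Z} → PAdicSmall p d (scal r) → r ℚ.* ι (p ^⁺ N) ≡ ι Z → p ^⁺ suc N ∣ Z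
  PAdicSmall-rational-∣ {r} {N} {Z} (u , v , w , m , p∤w , ex , ey , dv) rN =
    ^-∣ℤ-coprime-cancel {w = + w} pp p∤w (suc N) (divides μ wZ≡μp^N⁺¹)
    where
    open ≡-Reasoning
    W = + (w ℕ.* p ℕ.^ m)
    v≡0 : v ≡ + 0
    v≡0 = ι-injective (trans (sym ey) (ℚP.*-zeroˡ (ι W)))
    p^m⁺¹∣u : p ^⁺ suc m ∣ u
    p^m⁺¹∣u = subst (p ^⁺ suc m ∣_) (trans (cong (λ v → u ℤ.+ v ℤ.* d (suc m)) v≡0) (ℤP.+-identityʳ u)) (∣ᵤ⇒∣ dv)
    μ = ℤD._∣_.quotient p^m⁺¹∣u
    uN≡ZW : u ℤ.* p ^⁺ N ≡ Z ℤ.* W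
    uN≡ZW = ι-injective (begin
      ι (u ℤ.* p ^⁺ N)           ≡⟨ ι-homo-* u (p ^⁺ N) ⟩
      ι u ℚ.* ι (p ^⁺ N)         ≡⟨ cong (ℚ._* ι (p ^⁺ N)) (sym ex) ⟩
      r ℚ.* ι W ℚ.* ι (p ^⁺ N)   ≡⟨ solve 3 (λ r a b → r :* a :* b := r :* b :* a) refl r (ι W) (ι (p ^⁺ N)) ⟩
      r ℚ.* ι (p ^⁺ N) ℚ.* ι W   ≡⟨ cong (ℚ._* ι W) rN ⟩
      ι Z ℚ.* ι W                ≡⟨ sym (ι-homo-* Z W) ⟩
      ι (Z ℤ.* W)                ∎)
    wZ≡μp^N⁺¹ : + w ℤ.* Z ≡ μ ℤ.* p ^⁺ suc N
    wZ≡μp^N⁺¹ = ℤP.*-cancelʳ-≡ _ _ (p ^⁺ m) {{ℤ.≢-nonZero (^⁺-≢0 pp m)}} (begin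
      + w ℤ.* Z ℤ.* p ^⁺ m              ≡⟨ regroup (+ w) Z (p ^⁺ m) ⟩
      Z ℤ.* (+ w ℤ.* p ^⁺ m)            ≡⟨ cong (Z ℤ.*_) (sym (ℤP.pos-* w (p ℕ.^ m))) ⟩
      Z ℤ.* W                           ≡⟨ sym uN≡ZW ⟩
      u ℤ.* p ^⁺ N                      ≡⟨ cong (ℤ._* p ^⁺ N) (ℤD._∣_.equality p^m⁺¹∣u) ⟩
      μ ℤ.* p ^⁺ suc m ℤ.* p ^⁺ N       ≡⟨ cong (λ a → μ ℤ.* a ℤ.* p ^⁺ N) (^⁺-suc p m) ⟩
      μ ℤ.* (+ p ℤ.* p ^⁺ m) ℤ.* p ^⁺ N ≡⟨ regroup′ μ (+ p) (p ^⁺ m) (p ^⁺ N) ⟩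
      μ ℤ.* (+ p ℤ.* p ^⁺ N) ℤ.* p ^⁺ m ≡⟨ cong (λ a → μ ℤ.* a ℤ.* p ^⁺ m) (sym (^⁺-suc p N)) ⟩
      μ ℤ.* p ^⁺ suc N ℤ.* p ^⁺ m       ∎)
      where
      regroup : ∀ w Z a → w ℤ.* Z ℤ.* a ≡ Z ℤ.* (w ℤ.* a)
      regroup = ℤSolver.solve-∀
      regroup′ : ∀ μ P a b → μ ℤ.* (P ℤ.* a) ℤ.* b ≡ μ ℤ.* (P ℤ.* b) ℤ.* a
      regroup′ = ℤSolver.solve-∀

  -- c − c′ lies in ℤ[1/p] ∩ (−p, p) and is p-adically small, so it is 0.
  s-unique : ∀ {γ c c′} → IsS p d γ c → IsS p d γ c′ → c ≡ c′
  s-unique {x , y} {c} {c′} (((k , z , cz) , c> , c<) , small) (((k′ , z′ , cz′) , c′> , c′<) , small′) =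
    p-q≡0⇒p≡q c c′ (*-cancelʳ-≡ (c ℚ.- c′) 0ℚ (ι (a ℤ.* b)) (ι-≢0 (λ e → ^⁺-≢0 pp (k ℕ.+ k′) (trans (^⁺-+ p k k′) e)))
                      (trans scaled (trans (cong ι Z≡0) (sym (ℚP.*-zeroˡ (ι (a ℤ.* b)))))))
    where
    a = p ^⁺ k
    b = p ^⁺ k′
    Z = z ℤ.* b ℤ.- z′ ℤ.* a
    X = + p ℤ.* (a ℤ.* b)
    X≡ : p ^⁺ suc (k ℕ.+ k′) ≡ X
    X≡ = trans (^⁺-suc p (k ℕ.+ k′)) (cong (+ p ℤ.*_) (^⁺-+ p k k′))
    scaled : (c ℚ.- c′) ℚ.* ι (a ℤ.* b) ≡ ι Z
    scaled = trans (cong ((c ℚ.- c′) ℚ.*_) (ι-homo-* a b))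
                   (trans (sub-scaled c c′ (ι a) (ι b) (ι z) (ι z′) cz cz′) (sym (ι-homo-*-‿-* z b z′ a)))
    difference-small : PAdicSmall p d (scal (c ℚ.- c′))
    difference-small = subst (PAdicSmall p d) (cong₂ _,_ (cancel x c c′) (cancel₀ y)) (PAdicSmall-⊖ {(x , y) ⊖ scal c′} {(x , y) ⊖ scal c} small′ small)
      where
      cancel : ∀ x c c′ → (x ℚ.- c′) ℚ.- (x ℚ.- c) ≡ c ℚ.- c′
      cancel x c c′ = solve 3 (λ x c c′ → (x :- c′) :- (x :- c) := c :- c′) refl x c c′
      cancel₀ : ∀ y → (y ℚ.- 0ℚ) ℚ.- (y ℚ.- 0ℚ) ≡ 0ℚ
      cancel₀ y = solve 1 (λ y → (y :- con 0ℚ) :- (y :- con 0ℚ) := con 0ℚ) refl y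
    X∣Z : X ∣ Z
    X∣Z = subst (_∣ Z) X≡ (PAdicSmall-rational-∣ {c ℚ.- c′} {k ℕ.+ k′} difference-small
                             (trans (cong (λ e → (c ℚ.- c′) ℚ.* ι e) (^⁺-+ p k k′)) scaled))
    bounds = InY-cross-bounds {p} {c} {c′} {k} {k′} {z} {z′} pp cz cz′ c> c< c′> c′<
    Z≡0 : Z ≡ + 0
    Z≡0 = ∣∧bounded⇒≡0 (subst (+ 0 ℤ.<_) X≡ (^⁺-positive pp (suc (k ℕ.+ k′)))) X∣Z
            (proj₁ bounds) (proj₂ bounds)

  -- (x, y) = (r + δ)/Q with r ∈ ℤ[1/p]: smallness forces r ≡ −δ (mod p), so r has no p in its denominator.
  small-numerator-integral : ∀ {x y Q r k B} → PAdicSmall p d (x , y) → x ℚ.* ι Q ≡ r → y ℚ.* ι Q ≡ 1ℚ →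
                             r ℚ.* ι (p ^⁺ k) ≡ ι B → Σ ℤ λ A → r ≡ ι A
  small-numerator-integral {x} {y} {Q} {r} {k} {B} (u , v , w , m , p∤w , ex , ey , dv) xQ yQ rk
    with ∣ᵤ⇒∣ {p ^⁺ suc m} {u ℤ.+ v ℤ.* d (suc m)} dv
  ... | divides q u+vD≡ = ξ ℤ.* + p ℤ.- D , r≡ιA
    where
    open ≡-Reasoning
    W = + (w ℕ.* p ℕ.^ m)
    D = d (suc m)
    up^k≡vB : u ℤ.* p ^⁺ k ≡ v ℤ.* B
    up^k≡vB = ι-injective (begin
      ι (u ℤ.* p ^⁺ k)                         ≡⟨ ι-homo-* u (p ^⁺ k) ⟩
      ι u ℚ.* ι (p ^⁺ k)                       ≡⟨ cong (ℚ._* ι (p ^⁺ k)) (sym ex) ⟩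
      x ℚ.* ι W ℚ.* ι (p ^⁺ k)                 ≡⟨ sym (trans (cong (λ e → x ℚ.* ι W ℚ.* ι (p ^⁺ k) ℚ.* e) yQ) (ℚP.*-identityʳ _)) ⟩
      x ℚ.* ι W ℚ.* ι (p ^⁺ k) ℚ.* (y ℚ.* ι Q) ≡⟨ solve 5 (λ x a b y c → x :* a :* b :* (y :* c) := (y :* a) :* ((x :* c) :* b))
                                                        refl x (ι W) (ι (p ^⁺ k)) y (ι Q) ⟩
      (y ℚ.* ι W) ℚ.* ((x ℚ.* ι Q) ℚ.* ι (p ^⁺ k)) ≡⟨ cong₂ (λ a b → a ℚ.* (b ℚ.* ι (p ^⁺ k))) ey xQ ⟩
      ι v ℚ.* (r ℚ.* ι (p ^⁺ k))               ≡⟨ cong (ι v ℚ.*_) rk ⟩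
      ι v ℚ.* ι B                              ≡⟨ sym (ι-homo-* v B) ⟩
      ι (v ℤ.* B)                              ∎)
    X = D ℤ.* p ^⁺ k ℤ.+ B
    vX≡ : v ℤ.* X ≡ q ℤ.* p ^⁺ (suc k ℕ.+ m)
    vX≡ = begin
      v ℤ.* (D ℤ.* p ^⁺ k ℤ.+ B)           ≡⟨ distrib v D (p ^⁺ k) B ⟩
      v ℤ.* D ℤ.* p ^⁺ k ℤ.+ v ℤ.* B       ≡⟨ cong (λ e → v ℤ.* D ℤ.* p ^⁺ k ℤ.+ e) (sym up^k≡vB) ⟩
      v ℤ.* D ℤ.* p ^⁺ k ℤ.+ u ℤ.* p ^⁺ k  ≡⟨ collect u v D (p ^⁺ k) ⟩
      (u ℤ.+ v ℤ.* D) ℤ.* p ^⁺ k           ≡⟨ cong (ℤ._* p ^⁺ k) u+vD≡ ⟩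
      q ℤ.* p ^⁺ suc m ℤ.* p ^⁺ k          ≡⟨ trans (ℤP.*-assoc q _ _) (cong (q ℤ.*_) (sym (^⁺-+ p (suc m) k))) ⟩
      q ℤ.* p ^⁺ (suc m ℕ.+ k)             ≡⟨ cong (λ e → q ℤ.* p ^⁺ suc e) (ℕP.+-comm m k) ⟩
      q ℤ.* p ^⁺ (suc k ℕ.+ m)             ∎
      where
      distrib : ∀ v D a B → v ℤ.* (D ℤ.* a ℤ.+ B) ≡ v ℤ.* D ℤ.* a ℤ.+ v ℤ.* B
      distrib = ℤSolver.solve-∀
      collect : ∀ u v D a → v ℤ.* D ℤ.* a ℤ.+ u ℤ.* a ≡ (u ℤ.+ v ℤ.* D) ℤ.* a
      collect = ℤSolver.solve-∀
    p^k⁺¹∣X : p ^⁺ suc k ∣ X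
    p^k⁺¹∣X = ^-∣ℤ-coprime-cancel {w = + w} pp p∤w (suc k)
                (ℤD.∣-trans (divides Q refl) (p^[j+m]∣vX⇒Qp^j∣wX pp {v} {Q} {w} {m} {suc k} {X} (small-denominator {y} {Q} {v} {W} yQ ey) (divides q vX≡)))
    ξ = ℤD._∣_.quotient p^k⁺¹∣X
    B≡ : B ≡ (ξ ℤ.* + p ℤ.- D) ℤ.* p ^⁺ k
    B≡ = begin
      B                                            ≡⟨ isolate B D (p ^⁺ k) ⟩
      (D ℤ.* p ^⁺ k ℤ.+ B) ℤ.- D ℤ.* p ^⁺ k        ≡⟨ cong (ℤ._- D ℤ.* p ^⁺ k) (ℤD._∣_.equality p^k⁺¹∣X) ⟩
      ξ ℤ.* p ^⁺ suc k ℤ.- D ℤ.* p ^⁺ k            ≡⟨ cong (λ e → ξ ℤ.* e ℤ.- D ℤ.* p ^⁺ k) (^⁺-suc p k) ⟩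
      ξ ℤ.* (+ p ℤ.* p ^⁺ k) ℤ.- D ℤ.* p ^⁺ k      ≡⟨ collect ξ (+ p) (p ^⁺ k) D ⟩
      (ξ ℤ.* + p ℤ.- D) ℤ.* p ^⁺ k                 ∎
      where
      isolate : ∀ B D a → B ≡ (D ℤ.* a ℤ.+ B) ℤ.- D ℤ.* a
      isolate = ℤSolver.solve-∀
      collect : ∀ ξ P a D → ξ ℤ.* (P ℤ.* a) ℤ.- D ℤ.* a ≡ (ξ ℤ.* P ℤ.- D) ℤ.* a
      collect = ℤSolver.solve-∀
    r≡ιA : r ≡ ι (ξ ℤ.* + p ℤ.- D)
    r≡ιA = *-cancelʳ-≡ r _ (ι (p ^⁺ k)) (ι-≢0 (^⁺-≢0 pp k))
             (trans rk (trans (cong ι B≡) (ι-homo-* (ξ ℤ.* + p ℤ.- D) (p ^⁺ k))))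

  -- (x, y) = (A + δ)/Q: smallness gives p^(m+1) ∣ v(A + δ), hence p^(m+1) ∣ v(Δ − A²) = v(δ − A)(δ + A).
  small-form-∣ : ∀ {x y Q A} → PAdicSmall p d (x , y) → x ℚ.* ι Q ≡ ι A → y ℚ.* ι Q ≡ 1ℚ →
                 Σ ℕ λ w → ¬ p ℕD.∣ w × Q ∣ + w ℤ.* (Δ ℤ.- A ℤ.* A)
  small-form-∣ {x} {y} {Q} {A} (u , v , w , m , p∤w , ex , ey , dv) xQ yQ
    with ∣ᵤ⇒∣ {p ^⁺ suc m} {u ℤ.+ v ℤ.* d (suc m)} dv | ∣ᵤ⇒∣ {p ^⁺ suc m} {d (suc m) ℤ.* d (suc m) ℤ.- Δ} (proj₁ H (suc m))
  ... | divides q u+vD≡ | divides s D²-Δ≡ =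
    w , p∤w , ℤD.∣-trans (divides (p ^⁺ 1) (ℤP.*-comm Q (p ^⁺ 1)))
                          (p^[j+m]∣vX⇒Qp^j∣wX pp {v} {Q} {w} {m} {1} {G} (small-denominator {y} {Q} {v} {W} yQ ey) (divides g vG≡))
    where
    open ≡-Reasoning
    W = + (w ℕ.* p ℕ.^ m)
    D = d (suc m)
    G = Δ ℤ.- A ℤ.* A
    g = q ℤ.* (D ℤ.- A) ℤ.- v ℤ.* s
    u≡Av : u ≡ A ℤ.* v
    u≡Av = ι-injective (begin
      ι u                               ≡⟨ sym ex ⟩
      x ℚ.* ι W                         ≡⟨ sym (trans (cong (x ℚ.* ι W ℚ.*_) yQ) (ℚP.*-identityʳ _)) ⟩
      x ℚ.* ι W ℚ.* (y ℚ.* ι Q)         ≡⟨ solve 4 (λ x a y b → x :* a :* (y :* b) := (x :* b) :* (y :* a)) refl x (ι W) y (ι Q) ⟩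
      (x ℚ.* ι Q) ℚ.* (y ℚ.* ι W)       ≡⟨ cong₂ ℚ._*_ xQ ey ⟩
      ι A ℚ.* ι v                       ≡⟨ sym (ι-homo-* A v) ⟩
      ι (A ℤ.* v)                       ∎)
    vG≡ : v ℤ.* G ≡ g ℤ.* p ^⁺ suc m
    vG≡ = begin
      v ℤ.* G                                          ≡⟨ expand A v D Δ ⟩
      (A ℤ.* v ℤ.+ v ℤ.* D) ℤ.* (D ℤ.- A) ℤ.- v ℤ.* (D ℤ.* D ℤ.- Δ)
        ≡⟨ cong₂ (λ a b → (a ℤ.+ v ℤ.* D) ℤ.* (D ℤ.- A) ℤ.- v ℤ.* b) (sym u≡Av) D²-Δ≡ ⟩
      (u ℤ.+ v ℤ.* D) ℤ.* (D ℤ.- A) ℤ.- v ℤ.* (s ℤ.* p ^⁺ suc m)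
        ≡⟨ cong (λ a → a ℤ.* (D ℤ.- A) ℤ.- v ℤ.* (s ℤ.* p ^⁺ suc m)) u+vD≡ ⟩
      q ℤ.* p ^⁺ suc m ℤ.* (D ℤ.- A) ℤ.- v ℤ.* (s ℤ.* p ^⁺ suc m)
        ≡⟨ collect q v s (D ℤ.- A) (p ^⁺ suc m) ⟩
      g ℤ.* p ^⁺ suc m                                 ∎
      where
      expand : ∀ A v D Δ → v ℤ.* (Δ ℤ.- A ℤ.* A) ≡ (A ℤ.* v ℤ.+ v ℤ.* D) ℤ.* (D ℤ.- A) ℤ.- v ℤ.* (D ℤ.* D ℤ.- Δ)
      expand = ℤSolver.solve-∀
      collect : ∀ q v s e P → q ℤ.* P ℤ.* e ℤ.- v ℤ.* (s ℤ.* P) ≡ (q ℤ.* e ℤ.- v ℤ.* s) ℤ.* P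
      collect = ℤSolver.solve-∀

numerator-change-∣ : ∀ {p Δ P Q A z} l k → Q ∣ p ^⁺ l ℤ.* (Δ ℤ.- P ℤ.* P) → A ℤ.* p ^⁺ k ≡ P ℤ.* p ^⁺ k ℤ.- z ℤ.* Q →
                     Q ∣ p ^⁺ (l ℕ.+ (k ℕ.+ k)) ℤ.* (Δ ℤ.- A ℤ.* A)
numerator-change-∣ {p} {Δ} {P} {Q} {A} {z} l k (divides c c≡) Ap^k = divides (t ℤ.* t ℤ.* c ℤ.+ e) (begin
  p ^⁺ (l ℕ.+ (k ℕ.+ k)) ℤ.* (Δ ℤ.- A ℤ.* A)
    ≡⟨ cong (ℤ._* (Δ ℤ.- A ℤ.* A)) (trans (^⁺-+ p l (k ℕ.+ k)) (cong (L ℤ.*_) (^⁺-+ p k k))) ⟩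
  L ℤ.* (t ℤ.* t) ℤ.* (Δ ℤ.- A ℤ.* A)
    ≡⟨ regroup L t Δ A ⟩
  L ℤ.* (t ℤ.* t ℤ.* Δ ℤ.- (A ℤ.* t) ℤ.* (A ℤ.* t))
    ≡⟨ cong (λ s → L ℤ.* (t ℤ.* t ℤ.* Δ ℤ.- s ℤ.* s)) Ap^k ⟩
  L ℤ.* (t ℤ.* t ℤ.* Δ ℤ.- (P ℤ.* t ℤ.- z ℤ.* Q) ℤ.* (P ℤ.* t ℤ.- z ℤ.* Q))
    ≡⟨ expand L t Δ P z Q ⟩
  t ℤ.* t ℤ.* (L ℤ.* (Δ ℤ.- P ℤ.* P)) ℤ.+ e ℤ.* Q
    ≡⟨ cong (λ s → t ℤ.* t ℤ.* s ℤ.+ e ℤ.* Q) c≡ ⟩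
  t ℤ.* t ℤ.* (c ℤ.* Q) ℤ.+ e ℤ.* Q
    ≡⟨ collect t c Q e ⟩
  (t ℤ.* t ℤ.* c ℤ.+ e) ℤ.* Q ∎)
  where
  open ≡-Reasoning
  L = p ^⁺ l
  t = p ^⁺ k
  e = L ℤ.* z ℤ.* (+ 2 ℤ.* P ℤ.* t ℤ.- z ℤ.* Q)
  regroup : ∀ L t Δ A → L ℤ.* (t ℤ.* t) ℤ.* (Δ ℤ.- A ℤ.* A) ≡ L ℤ.* (t ℤ.* t ℤ.* Δ ℤ.- (A ℤ.* t) ℤ.* (A ℤ.* t))
  regroup = ℤSolver.solve-∀
  expand : ∀ L t Δ P z Q → L ℤ.* (t ℤ.* t ℤ.* Δ ℤ.- (P ℤ.* t ℤ.- z ℤ.* Q) ℤ.* (P ℤ.* t ℤ.- z ℤ.* Q))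
                         ≡ t ℤ.* t ℤ.* (L ℤ.* (Δ ℤ.- P ℤ.* P)) ℤ.+ L ℤ.* z ℤ.* (+ 2 ℤ.* P ℤ.* t ℤ.- z ℤ.* Q) ℤ.* Q
  expand = ℤSolver.solve-∀
  collect : ∀ t c Q e → t ℤ.* t ℤ.* (c ℤ.* Q) ℤ.+ e ℤ.* Q ≡ (t ℤ.* t ℤ.* c ℤ.+ e) ℤ.* Q
  collect = ℤSolver.solve-∀

-- Complete quotients of the form (P + δ)/Q

mulδ-scal : ∀ Δ c x y → mulδ Δ (scal c) (x , y) ≡ (c ℚ.* x , c ℚ.* y)
mulδ-scal Δ c x y = cong₂ _,_
  (solve 4 (λ c x y D → c :* x :+ D :* (con 0ℚ :* y) := c :* x) refl c x y (ι Δ))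
  (solve 3 (λ c x y → c :* y :+ con 0ℚ :* x := c :* y) refl c x y)

record HasForm (γ : Qδ) (P Q : ℤ) : Set where
  field
    Q≢0 : Q ≢ + 0
    numerator : proj₁ γ ℚ.* ι Q ≡ ι P
    denominator : proj₂ γ ℚ.* ι Q ≡ 1ℚ

HasForm-injective : ∀ {γ γ′ P Q} → HasForm γ P Q → HasForm γ′ P Q → γ ≡ γ′
HasForm-injective {x , y} {x′ , y′} {P} {Q} f f′ = cong₂ _,_
  (*-cancelʳ-≡ x x′ (ι Q) ιQ≢0 (trans (numerator f) (sym (numerator f′))))
  (*-cancelʳ-≡ y y′ (ι Q) ιQ≢0 (trans (denominator f) (sym (denominator f′))))
  where
  open HasForm
  ιQ≢0 = ι-≢0 (Q≢0 f)

inverse-form : ∀ {Δ x y x′ y′ A K Q Q′} → K ≢ + 0 → Q ≢ + 0 → Q′ ≢ + 0 →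
  x ℚ.* ι Q ≡ ι K ℚ.* ι A → y ℚ.* ι Q ≡ ι K → Q′ ℤ.* Q ≡ K ℤ.* (Δ ℤ.- A ℤ.* A) →
  mulδ Δ (x′ , y′) (x , y) ≡ scal 1ℚ → HasForm (x′ , y′) (ℤ.- A) Q′
inverse-form {Δ} {x} {y} {x′} {y′} {A} {K} {Q} {Q′} K≢0 Q≢0 Q′≢0 xQ yQ Q′Q inv = record
  { Q≢0 = Q′≢0 ; numerator = x′Q′ ; denominator = y′Q′ }
  where
  open ≡-Reasoning
  q = ι Q
  k = ι K
  a = ι A
  D = ι Δ
  first : x′ ℚ.* x ℚ.+ D ℚ.* (y′ ℚ.* y) ≡ 1ℚ
  first = cong proj₁ inv
  second : x′ ℚ.* y ℚ.+ y′ ℚ.* x ≡ 0ℚ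
  second = cong proj₂ inv
  q′q : ι Q′ ℚ.* q ≡ k ℚ.* (D ℚ.- a ℚ.* a)
  q′q = begin
    ι Q′ ℚ.* q                  ≡⟨ sym (ι-homo-* Q′ Q) ⟩
    ι (Q′ ℤ.* Q)                ≡⟨ cong ι Q′Q ⟩
    ι (K ℤ.* (Δ ℤ.- A ℤ.* A))   ≡⟨ trans (ι-homo-* K _) (cong (k ℚ.*_) (trans (ι-homo-‿- Δ (A ℤ.* A)) (cong (λ t → D ℚ.- t) (ι-homo-* A A)))) ⟩
    k ℚ.* (D ℚ.- a ℚ.* a)       ∎
  x′≡ : x′ ≡ ℚ.- (y′ ℚ.* a)
  x′≡ = p-q≡0⇒p≡q x′ _ (*-cancelʳ-≡ _ 0ℚ k (ι-≢0 K≢0) (begin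
    (x′ ℚ.- ℚ.- (y′ ℚ.* a)) ℚ.* k   ≡⟨ solve 4 (λ x′ y′ a k → (x′ :- :- (y′ :* a)) :* k := x′ :* k :+ y′ :* (k :* a)) refl x′ y′ a k ⟩
    x′ ℚ.* k ℚ.+ y′ ℚ.* (k ℚ.* a)   ≡⟨ cong₂ (λ s t → x′ ℚ.* s ℚ.+ y′ ℚ.* t) (sym yQ) (sym xQ) ⟩
    x′ ℚ.* (y ℚ.* q) ℚ.+ y′ ℚ.* (x ℚ.* q) ≡⟨ solve 5 (λ x′ y y′ x q → x′ :* (y :* q) :+ y′ :* (x :* q) := (x′ :* y :+ y′ :* x) :* q) refl x′ y y′ x q ⟩
    (x′ ℚ.* y ℚ.+ y′ ℚ.* x) ℚ.* q   ≡⟨ cong (ℚ._* q) second ⟩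
    0ℚ ℚ.* q                        ≡⟨ ℚP.*-zeroˡ q ⟩
    0ℚ                              ≡⟨ sym (ℚP.*-zeroˡ k) ⟩
    0ℚ ℚ.* k                        ∎))
  y′Q′q≡q : y′ ℚ.* ι Q′ ℚ.* q ≡ 1ℚ ℚ.* q
  y′Q′q≡q = begin
    y′ ℚ.* ι Q′ ℚ.* q                                  ≡⟨ trans (ℚP.*-assoc y′ (ι Q′) q) (cong (y′ ℚ.*_) q′q) ⟩
    y′ ℚ.* (k ℚ.* (D ℚ.- a ℚ.* a))                     ≡⟨ solve 4 (λ y′ k D a → y′ :* (k :* (D :- a :* a)) := (:- (y′ :* a)) :* (k :* a) :+ D :* (y′ :* k)) refl y′ k D a ⟩
    ℚ.- (y′ ℚ.* a) ℚ.* (k ℚ.* a) ℚ.+ D ℚ.* (y′ ℚ.* k)  ≡⟨ cong₂ (λ s t → s ℚ.* t ℚ.+ D ℚ.* (y′ ℚ.* k)) (sym x′≡) (sym xQ) ⟩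
    x′ ℚ.* (x ℚ.* q) ℚ.+ D ℚ.* (y′ ℚ.* k)             ≡⟨ cong (λ t → x′ ℚ.* (x ℚ.* q) ℚ.+ D ℚ.* (y′ ℚ.* t)) (sym yQ) ⟩
    x′ ℚ.* (x ℚ.* q) ℚ.+ D ℚ.* (y′ ℚ.* (y ℚ.* q))     ≡⟨ solve 6 (λ x′ x D y′ y q → x′ :* (x :* q) :+ D :* (y′ :* (y :* q)) := (x′ :* x :+ D :* (y′ :* y)) :* q) refl x′ x D y′ y q ⟩
    (x′ ℚ.* x ℚ.+ D ℚ.* (y′ ℚ.* y)) ℚ.* q             ≡⟨ cong (ℚ._* q) first ⟩
    1ℚ ℚ.* q                                           ∎
  y′Q′ : y′ ℚ.* ι Q′ ≡ 1ℚ
  y′Q′ = *-cancelʳ-≡ _ 1ℚ q (ι-≢0 Q≢0) y′Q′q≡q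
  x′Q′ : x′ ℚ.* ι Q′ ≡ ι (ℤ.- A)
  x′Q′ = begin
    x′ ℚ.* ι Q′                    ≡⟨ cong (ℚ._* ι Q′) x′≡ ⟩
    ℚ.- (y′ ℚ.* a) ℚ.* ι Q′        ≡⟨ solve 3 (λ y′ a q′ → :- (y′ :* a) :* q′ := :- ((y′ :* q′) :* a)) refl y′ a (ι Q′) ⟩
    ℚ.- ((y′ ℚ.* ι Q′) ℚ.* a)      ≡⟨ cong (λ t → ℚ.- (t ℚ.* a)) y′Q′ ⟩
    ℚ.- (1ℚ ℚ.* a)                 ≡⟨ cong ℚ.-_ (ℚP.*-identityˡ a) ⟩
    ℚ.- a                          ≡⟨ sym (ι-homo-neg A) ⟩
    ι (ℤ.- A)                      ∎

module Step {p : ℕ} (pp : Prime p) {Δ : ℤ} {d : ℕ → ℤ} (H : IsPAdicSqrt p Δ d) (nonsquare : ∀ z → z ℤ.* z ≢ Δ) where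

  open PAdic pp {Δ} {d} H

  nonsquare⇒≢0 : ∀ A → Δ ℤ.- A ℤ.* A ≢ + 0
  nonsquare⇒≢0 A e = nonsquare A (sym (begin
    Δ                                 ≡⟨ split Δ (A ℤ.* A) ⟩
    (Δ ℤ.- A ℤ.* A) ℤ.+ A ℤ.* A       ≡⟨ cong (ℤ._+ A ℤ.* A) e ⟩
    + 0 ℤ.+ A ℤ.* A                   ≡⟨ ℤP.+-identityˡ (A ℤ.* A) ⟩
    A ℤ.* A                           ∎))
    where
    open ≡-Reasoning
    split : ∀ a b → a ≡ (a ℤ.- b) ℤ.+ b
    split = ℤSolver.solve-∀

  -- Q divides both w(Δ − A²) with p ∤ w (small-form-∣) and a power of p times Δ − A² (numerator-change-∣).
  next-form : ∀ {γ γ′ P Q a} l → HasForm γ P Q → Q ∣ p ^⁺ l ℤ.* (Δ ℤ.- P ℤ.* P) → IsS p d γ a →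
              mulδ Δ γ′ (γ ⊖ scal a) ≡ scal 1ℚ →
              Σ ℤ λ P′ → Σ ℤ λ Q′ → HasForm γ′ P′ Q′ × Q ℤ.* Q′ ≡ Δ ℤ.- P′ ℤ.* P′
  next-form {x , y} {x′ , y′} {P} {Q} {a} l f Q∣ (((k , z , az) , _ , _) , small) inv =
    ℤ.- A , Q′ , form , QQ′
    where
    open ≡-Reasoning
    open HasForm f
    r = ι P ℚ.- a ℚ.* ι Q
    xQ : (x ℚ.- a) ℚ.* ι Q ≡ r
    xQ = trans (solve 3 (λ x a q → (x :- a) :* q := x :* q :- a :* q) refl x a (ι Q)) (cong (ℚ._- a ℚ.* ι Q) numerator)
    yQ : (y ℚ.- 0ℚ) ℚ.* ι Q ≡ 1ℚ
    yQ = trans (solve 2 (λ y q → (y :- con 0ℚ) :* q := y :* q) refl y (ι Q)) denominator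
    rk : r ℚ.* ι (p ^⁺ k) ≡ ι (P ℤ.* p ^⁺ k ℤ.- z ℤ.* Q)
    rk = begin
      (ι P ℚ.- a ℚ.* ι Q) ℚ.* ι (p ^⁺ k)               ≡⟨ solve 4 (λ P a q t → (P :- a :* q) :* t := P :* t :- (a :* t) :* q) refl (ι P) a (ι Q) (ι (p ^⁺ k)) ⟩
      ι P ℚ.* ι (p ^⁺ k) ℚ.- (a ℚ.* ι (p ^⁺ k)) ℚ.* ι Q ≡⟨ cong (λ t → ι P ℚ.* ι (p ^⁺ k) ℚ.- t ℚ.* ι Q) az ⟩
      ι P ℚ.* ι (p ^⁺ k) ℚ.- ι z ℚ.* ι Q               ≡⟨ sym (ι-homo-*-‿-* P (p ^⁺ k) z Q) ⟩
      ι (P ℤ.* p ^⁺ k ℤ.- z ℤ.* Q)                     ∎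
    A-integral = small-numerator-integral {x ℚ.- a} {y ℚ.- 0ℚ} {Q} {r} {k} {P ℤ.* p ^⁺ k ℤ.- z ℤ.* Q} small xQ yQ rk
    A = proj₁ A-integral
    r≡ιA : r ≡ ι A
    r≡ιA = proj₂ A-integral
    Ap^k : A ℤ.* p ^⁺ k ≡ P ℤ.* p ^⁺ k ℤ.- z ℤ.* Q
    Ap^k = ι-injective (trans (ι-homo-* A (p ^⁺ k)) (trans (cong (ℚ._* ι (p ^⁺ k)) (sym r≡ιA)) rk))
    G = Δ ℤ.- A ℤ.* A
    Q∣wG = small-form-∣ {x ℚ.- a} {y ℚ.- 0ℚ} {Q} {A} small (trans xQ r≡ιA) yQ
    Q∣G : Q ∣ G
    Q∣G = ∣ℤ-^-coprime-cancel {w = + proj₁ Q∣wG} pp (proj₁ (proj₂ Q∣wG)) (l ℕ.+ (k ℕ.+ k)) (proj₂ (proj₂ Q∣wG))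
            (numerator-change-∣ {p} {Δ} {P} {Q} {A} {z} l k Q∣ Ap^k)
    Q′ = ℤD._∣_.quotient Q∣G
    G≡Q′Q : G ≡ Q′ ℤ.* Q
    G≡Q′Q = ℤD._∣_.equality Q∣G
    Q′≢0 : Q′ ≢ + 0
    Q′≢0 Q′≡0 = nonsquare⇒≢0 A (trans G≡Q′Q (trans (cong (ℤ._* Q) Q′≡0) (ℤP.*-zeroˡ Q)))
    form : HasForm (x′ , y′) (ℤ.- A) Q′
    form = inverse-form {Δ} {K = + 1} (λ ()) Q≢0 Q′≢0 (trans (trans xQ r≡ιA) (sym (ℚP.*-identityˡ (ι A)))) yQ
             (trans (sym G≡Q′Q) (sym (ℤP.*-identityˡ G))) inv
    QQ′ : Q ℤ.* Q′ ≡ Δ ℤ.- ℤ.- A ℤ.* ℤ.- A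
    QQ′ = trans (ℤP.*-comm Q Q′) (trans (sym G≡Q′Q) (cong (λ t → Δ ℤ.- t) (sym (-i*-i≡i*i A))))

  -- For α₁ the divisibility Q ∣ pˡ(Δ − P²) needs a power of p coming from k₀; from α₂ on l = 0.
  record AdmissibleForm (γ : Qδ) : Set where
    field
      P Q : ℤ
      l : ℕ
      form : HasForm γ P Q
      Q∣ : Q ∣ p ^⁺ l ℤ.* (Δ ℤ.- P ℤ.* P)

  opaque
    next-admissible : ∀ {γ γ′ a} (F : AdmissibleForm γ) → IsS p d γ a → mulδ Δ γ′ (γ ⊖ scal a) ≡ scal 1ℚ →
                      Σ (AdmissibleForm γ′) λ F′ → AdmissibleForm.Q F ℤ.* AdmissibleForm.Q F′ ≡
                                                   Δ ℤ.- AdmissibleForm.P F′ ℤ.* AdmissibleForm.P F′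
    next-admissible {γ} {γ′} F s inv = record
      { P = P′ ; Q = proj₁ (proj₂ step) ; l = 0 ; form = proj₁ (proj₂ (proj₂ step))
      ; Q∣ = divides (AdmissibleForm.Q F) (trans (ℤP.*-identityˡ (Δ ℤ.- P′ ℤ.* P′)) (sym QQ′)) } , QQ′
      where
      step : Σ ℤ λ P′ → Σ ℤ λ Q′ → HasForm γ′ P′ Q′ × AdmissibleForm.Q F ℤ.* Q′ ≡ Δ ℤ.- P′ ℤ.* P′
      step = next-form (AdmissibleForm.l F) (AdmissibleForm.form F) (AdmissibleForm.Q∣ F) s inv
      P′ : ℤ
      P′ = proj₁ step
      QQ′ : AdmissibleForm.Q F ℤ.* proj₁ (proj₂ step) ≡ Δ ℤ.- P′ ℤ.* P′
      QQ′ = proj₂ (proj₂ (proj₂ step))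

  initial-admissible : ∀ {α₀ b₀ c₀ n} → ¬ (+ p ∣ℤ c₀) → c₀ ∣ℤ (Δ ℤ.- b₀ ℤ.* b₀) →
                       IsAlphaForm p Δ α₀ b₀ c₀ (+ n) → AdmissibleForm α₀
  initial-admissible {x , y} {b₀} {c₀} {n} p∤c₀ c₀∣ αf with ∣ᵤ⇒∣ c₀∣
  ... | divides e e≡ = record
    { P = b₀ ; Q = Q ; l = n
    ; form = record { Q≢0 = *-≢0 (^⁺-≢0 pp n) (∤⇒≢0 p∤c₀)
                    ; numerator = trans (ℚP.*-comm x (ι Q)) (cong proj₁ qα)
                    ; denominator = trans (ℚP.*-comm y (ι Q)) (cong proj₂ qα) }
    ; Q∣ = divides e (trans (cong (p ^⁺ n ℤ.*_) e≡) (regroup (p ^⁺ n) e c₀)) }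
    where
    Q = p ^⁺ n ℤ.* c₀
    qα : (ι Q ℚ.* x , ι Q ℚ.* y) ≡ (ι b₀ , 1ℚ)
    qα = trans (sym (mulδ-scal Δ (ι Q) x y)) αf
    regroup : ∀ a e c → a ℤ.* (e ℤ.* c) ≡ e ℤ.* (a ℤ.* c)
    regroup = ℤSolver.solve-∀

  -- For k₀ < 0, α₀ is p-adically small, so a₀ = 0 and α₁ = 1/α₀ = (−b₀ + δ)/(p^(n+1) e) where c₀e = Δ − b₀².
  module _ {x y b₀ c₀ n} (αf : IsAlphaForm p Δ (x , y) b₀ c₀ -[1+ n ]) where

    private
      K = p ^⁺ suc n
      c₀α : (ι c₀ ℚ.* x , ι c₀ ℚ.* y) ≡ (ι K ℚ.* ι b₀ , ι K ℚ.* 1ℚ)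
      c₀α = trans (sym (mulδ-scal Δ (ι c₀) x y)) (trans αf (mulδ-scal Δ (ι K) (ι b₀) 1ℚ))

    x-negative-form : (x ℚ.- 0ℚ) ℚ.* ι c₀ ≡ ι K ℚ.* ι b₀
    x-negative-form = trans (solve 2 (λ x c → (x :- con 0ℚ) :* c := c :* x) refl x (ι c₀)) (cong proj₁ c₀α)

    y-negative-form : (y ℚ.- 0ℚ) ℚ.* ι c₀ ≡ ι K
    y-negative-form = trans (solve 2 (λ y c → (y :- con 0ℚ) :* c := c :* y) refl y (ι c₀))
                            (trans (cong proj₂ c₀α) (ℚP.*-identityʳ (ι K)))

    α₀-small : ¬ (+ p ∣ℤ c₀) → IsS p d (x , y) 0ℚ
    α₀-small p∤c₀ = InY-0ℚ pp , (s ℤ.* (K ℤ.* b₀) , s ℤ.* K , ℤ.∣ c₀ ∣ , 0 , p∤c₀ ,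
                             scaled {x} (trans x-negative-form (sym (ι-homo-* K b₀))) , scaled {y} y-negative-form , ∣⇒∣ᵤ p∣)
      where
      open ≡-Reasoning
      s = proj₁ (sign-witness c₀)
      W≡ : + (ℤ.∣ c₀ ∣ ℕ.* p ℕ.^ 0) ≡ s ℤ.* c₀
      W≡ = trans (cong +_ (ℕP.*-identityʳ ℤ.∣ c₀ ∣)) (sym (proj₂ (sign-witness c₀)))
      scaled : ∀ {z T} → (z ℚ.- 0ℚ) ℚ.* ι c₀ ≡ ι T → (z ℚ.- 0ℚ) ℚ.* ι (+ (ℤ.∣ c₀ ∣ ℕ.* p ℕ.^ 0)) ≡ ι (s ℤ.* T)
      scaled {z} {T} h = begin
        (z ℚ.- 0ℚ) ℚ.* ι (+ (ℤ.∣ c₀ ∣ ℕ.* p ℕ.^ 0)) ≡⟨ cong (λ w → (z ℚ.- 0ℚ) ℚ.* ι w) W≡ ⟩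
        (z ℚ.- 0ℚ) ℚ.* ι (s ℤ.* c₀)                ≡⟨ cong ((z ℚ.- 0ℚ) ℚ.*_) (ι-homo-* s c₀) ⟩
        (z ℚ.- 0ℚ) ℚ.* (ι s ℚ.* ι c₀)              ≡⟨ solve 3 (λ z s c → (z :- con 0ℚ) :* (s :* c) := s :* ((z :- con 0ℚ) :* c)) refl z (ι s) (ι c₀) ⟩
        ι s ℚ.* ((z ℚ.- 0ℚ) ℚ.* ι c₀)              ≡⟨ cong (ι s ℚ.*_) h ⟩
        ι s ℚ.* ι T                                ≡⟨ sym (ι-homo-* s T) ⟩
        ι (s ℤ.* T)                                ∎
      p∣ : + (p ℕ.^ 1) ∣ s ℤ.* (K ℤ.* b₀) ℤ.+ s ℤ.* K ℤ.* d 1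
      p∣ = divides (s ℤ.* p ^⁺ n ℤ.* (b₀ ℤ.+ d 1)) (begin
        s ℤ.* (K ℤ.* b₀) ℤ.+ s ℤ.* K ℤ.* d 1                            ≡⟨ cong (λ k → s ℤ.* (k ℤ.* b₀) ℤ.+ s ℤ.* k ℤ.* d 1) (^⁺-suc p n) ⟩
        s ℤ.* (+ p ℤ.* p ^⁺ n ℤ.* b₀) ℤ.+ s ℤ.* (+ p ℤ.* p ^⁺ n) ℤ.* d 1 ≡⟨ collect s (+ p) (p ^⁺ n) b₀ (d 1) ⟩
        s ℤ.* p ^⁺ n ℤ.* (b₀ ℤ.+ d 1) ℤ.* + p                           ≡⟨ cong (λ q → s ℤ.* p ^⁺ n ℤ.* (b₀ ℤ.+ d 1) ℤ.* + q) (sym (ℕP.*-identityʳ p)) ⟩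
        s ℤ.* p ^⁺ n ℤ.* (b₀ ℤ.+ d 1) ℤ.* + (p ℕ.^ 1)                   ∎)
        where
        collect : ∀ s P a b D → s ℤ.* (P ℤ.* a ℤ.* b) ℤ.+ s ℤ.* (P ℤ.* a) ℤ.* D ≡ s ℤ.* a ℤ.* (b ℤ.+ D) ℤ.* P
        collect = ℤSolver.solve-∀

    second-admissible : ∀ {α₁ a₀} → ¬ (+ p ∣ℤ c₀) → c₀ ∣ℤ (Δ ℤ.- b₀ ℤ.* b₀) → IsS p d (x , y) a₀ →
                        mulδ Δ α₁ ((x , y) ⊖ scal a₀) ≡ scal 1ℚ → AdmissibleForm α₁
    second-admissible {α₁} {a₀} p∤c₀ c₀∣ s₀ inv = record
      { P = ℤ.- b₀ ; Q = K ℤ.* e ; l = suc n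
      ; form = inverse-form {Δ} {K = K} (^⁺-≢0 pp (suc n)) (∤⇒≢0 p∤c₀) Ke≢0 x-negative-form y-negative-form Kec₀ inv₀
      ; Q∣ = divides c₀ (trans (cong (λ t → K ℤ.* (Δ ℤ.- t)) (-i*-i≡i*i b₀)) (trans (sym Kec₀) (ℤP.*-comm (K ℤ.* e) c₀))) }
      where
      c₀∣′ : c₀ ∣ Δ ℤ.- b₀ ℤ.* b₀
      c₀∣′ = ∣ᵤ⇒∣ {c₀} {Δ ℤ.- b₀ ℤ.* b₀} c₀∣
      e = ℤD._∣_.quotient c₀∣′
      e≡ : Δ ℤ.- b₀ ℤ.* b₀ ≡ e ℤ.* c₀
      e≡ = ℤD._∣_.equality c₀∣′
      inv₀ : mulδ Δ α₁ ((x , y) ⊖ scal 0ℚ) ≡ scal 1ℚ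
      inv₀ = subst (λ c → mulδ Δ α₁ ((x , y) ⊖ scal c) ≡ scal 1ℚ) (s-unique {x , y} {a₀} {0ℚ} s₀ (α₀-small p∤c₀)) inv
      Ke≢0 : K ℤ.* e ≢ + 0
      Ke≢0 = *-≢0 (^⁺-≢0 pp (suc n)) (λ e≡0 → nonsquare⇒≢0 b₀ (trans e≡ (cong (ℤ._* c₀) e≡0)))
      Kec₀ : K ℤ.* e ℤ.* c₀ ≡ K ℤ.* (Δ ℤ.- b₀ ℤ.* b₀)
      Kec₀ = trans (ℤP.*-assoc K e c₀) (cong (K ℤ.*_) (sym e≡))

  first-admissible : ∀ {α₀ α₁ a₀ b₀ c₀ k₀} → ¬ (+ p ∣ℤ c₀) → c₀ ∣ℤ (Δ ℤ.- b₀ ℤ.* b₀) → IsAlphaForm p Δ α₀ b₀ c₀ k₀ →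
                     IsS p d α₀ a₀ → mulδ Δ α₁ (α₀ ⊖ scal a₀) ≡ scal 1ℚ → AdmissibleForm α₁
  first-admissible {α₀} {α₁} {a₀} {b₀} {c₀} {+ n} p∤c₀ c₀∣ αf s₀ inv =
    proj₁ (next-admissible {α₀} {α₁} {a₀} (initial-admissible {α₀} {b₀} {c₀} {n} p∤c₀ c₀∣ αf) s₀ inv)
  first-admissible {x , y} {α₁} {a₀} {b₀} {c₀} { -[1+ n ]} p∤c₀ c₀∣ αf s₀ inv =
    second-admissible {x} {y} {b₀} {c₀} {n} αf {α₁} {a₀} p∤c₀ c₀∣ s₀ inv

-- Negative norms and the box of possible (P, |Q|)

normδ-of-form : ∀ {Δ γ P Q} → HasForm γ P Q → normδ Δ γ ℚ.* ι (Q ℤ.* Q) ≡ ι (P ℤ.* P ℤ.- Δ)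
normδ-of-form {Δ} {x , y} {P} {Q} f = begin
  (x ℚ.* x ℚ.- ι Δ ℚ.* (y ℚ.* y)) ℚ.* ι (Q ℤ.* Q)
    ≡⟨ cong ((x ℚ.* x ℚ.- ι Δ ℚ.* (y ℚ.* y)) ℚ.*_) (ι-homo-* Q Q) ⟩
  (x ℚ.* x ℚ.- ι Δ ℚ.* (y ℚ.* y)) ℚ.* (ι Q ℚ.* ι Q)
    ≡⟨ solve 4 (λ x y D q → (x :* x :- D :* (y :* y)) :* (q :* q) := (x :* q) :* (x :* q) :- D :* ((y :* q) :* (y :* q))) refl x y (ι Δ) (ι Q) ⟩
  (x ℚ.* ι Q) ℚ.* (x ℚ.* ι Q) ℚ.- ι Δ ℚ.* ((y ℚ.* ι Q) ℚ.* (y ℚ.* ι Q))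
    ≡⟨ cong₂ (λ a b → a ℚ.* a ℚ.- ι Δ ℚ.* (b ℚ.* b)) numerator denominator ⟩
  ι P ℚ.* ι P ℚ.- ι Δ ℚ.* (1ℚ ℚ.* 1ℚ)
    ≡⟨ cong (λ t → ι P ℚ.* ι P ℚ.- t) (ℚP.*-identityʳ (ι Δ)) ⟩
  ι P ℚ.* ι P ℚ.- ι Δ
    ≡⟨ cong (ℚ._- ι Δ) (sym (ι-homo-* P P)) ⟩
  ι (P ℤ.* P) ℚ.- ι Δ
    ≡⟨ sym (ι-homo-‿- (P ℤ.* P) Δ) ⟩
  ι (P ℤ.* P ℤ.- Δ) ∎
  where
  open ≡-Reasoning
  open HasForm f

square-positive : ∀ Q → Q ≢ + 0 → + 0 ℤ.< Q ℤ.* Q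
square-positive (+ zero) Q≢0 = ⊥-elim (Q≢0 refl)
square-positive +[1+ n ] _ = ℤ.+<+ (ℕ.s≤s ℕ.z≤n)
square-positive -[1+ n ] _ = ℤ.+<+ (ℕ.s≤s ℕ.z≤n)

normδ<0⇒P²<Δ : ∀ {Δ γ P Q} → HasForm γ P Q → normδ Δ γ ℚ.< 0ℚ → + 0 ℤ.< Δ ℤ.- P ℤ.* P
normδ<0⇒P²<Δ {Δ} {γ} {P} {Q} f N<0 =
  subst (+ 0 ℤ.<_) (flip P Δ) (ℤP.neg-mono-< (ι-cancel-< {P ℤ.* P ℤ.- Δ} {+ 0} (subst₂ ℚ._<_ (normδ-of-form f) (ℚP.*-zeroˡ (ι (Q ℤ.* Q)))
                                                           (ℚP.*-monoˡ-<-pos (ι (Q ℤ.* Q)) N<0))))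
  where
  instance _ = ι-positive (square-positive Q (HasForm.Q≢0 f))
  flip : ∀ P Δ → ℤ.- (P ℤ.* P ℤ.- Δ) ≡ Δ ℤ.- P ℤ.* P
  flip = ℤSolver.solve-∀

row : ℕ → ℤ → List (ℤ × ℕ)
row D P = map (λ q → P , suc q) (upTo (D ∸ ℤ.∣ P ∣ ℕ.* ℤ.∣ P ∣))

-- The pairs (P, |Q|) allowed by in-box; by Kconst≡1+length-box there are K − 1 of them.
box : ℕ → ℕ → List (ℤ × ℕ)
box D zero = row D (+ 0)
box D (suc j) = row D (+ suc j) ++ row D -[1+ j ] ++ box D j

∈-row : ∀ D P {q} → 0 ℕ.< q → q ℕ.≤ D ∸ ℤ.∣ P ∣ ℕ.* ℤ.∣ P ∣ → (P , q) ∈ row D P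
∈-row D P {suc q} _ q≤ = ∈-map⁺ (λ q → P , suc q) (∈-upTo⁺ q≤)

∈-box : ∀ D t P {q} → ℤ.∣ P ∣ ℕ.≤ t → 0 ℕ.< q → q ℕ.≤ D ∸ ℤ.∣ P ∣ ℕ.* ℤ.∣ P ∣ → (P , q) ∈ box D t
∈-box D zero (+ zero) _ q>0 q≤ = ∈-row D (+ 0) q>0 q≤
∈-box D (suc j) (+ n) ∣P∣≤ q>0 q≤ with ℕP.m≤n⇒m<n∨m≡n ∣P∣≤
... | inj₂ refl = ∈-++⁺ˡ (∈-row D (+ n) q>0 q≤)
... | inj₁ (ℕ.s≤s n≤j) = ∈-++⁺ʳ (row D (+ suc j)) (∈-++⁺ʳ (row D -[1+ j ]) (∈-box D j (+ n) n≤j q>0 q≤))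
∈-box D (suc j) -[1+ n ] ∣P∣≤ q>0 q≤ with ℕP.m≤n⇒m<n∨m≡n ∣P∣≤
... | inj₂ refl = ∈-++⁺ʳ (row D (+ suc j)) (∈-++⁺ˡ (∈-row D -[1+ n ] q>0 q≤))
... | inj₁ (ℕ.s≤s n<j) = ∈-++⁺ʳ (row D (+ suc j)) (∈-++⁺ʳ (row D -[1+ j ]) (∈-box D j -[1+ n ] n<j q>0 q≤))

length-row : ∀ D P → length (row D P) ≡ D ∸ ℤ.∣ P ∣ ℕ.* ℤ.∣ P ∣
length-row D P = trans (LP.length-map (λ q → P , suc q) (upTo n)) (LP.length-upTo n)
  where n = D ∸ ℤ.∣ P ∣ ℕ.* ℤ.∣ P ∣

length-box : ∀ D t → t ℕ.* t ℕ.≤ D →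
  3 ℕ.* length (box D t) ℕ.+ t ℕ.* (t ℕ.+ 1) ℕ.* (2 ℕ.* t ℕ.+ 1) ≡ 3 ℕ.* ((2 ℕ.* t ℕ.+ 1) ℕ.* D)
length-box D zero _ = trans (cong (λ n → 3 ℕ.* n ℕ.+ 0) (length-row D (+ 0))) (unit D)
  where
  unit : ∀ D → 3 ℕ.* D ℕ.+ 0 ≡ 3 ℕ.* ((2 ℕ.* 0 ℕ.+ 1) ℕ.* D)
  unit = ℕSolver.solve-∀
length-box D (suc j) j²≤D = begin
  3 ℕ.* length (box D (suc j)) ℕ.+ suc j ℕ.* (suc j ℕ.+ 1) ℕ.* (2 ℕ.* suc j ℕ.+ 1)
    ≡⟨ cong (λ n → 3 ℕ.* n ℕ.+ suc j ℕ.* (suc j ℕ.+ 1) ℕ.* (2 ℕ.* suc j ℕ.+ 1)) length-split ⟩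
  3 ℕ.* (r ℕ.+ (r ℕ.+ L)) ℕ.+ suc j ℕ.* (suc j ℕ.+ 1) ℕ.* (2 ℕ.* suc j ℕ.+ 1)
    ≡⟨ peel r L j ⟩
  6 ℕ.* r ℕ.+ (3 ℕ.* L ℕ.+ j ℕ.* (j ℕ.+ 1) ℕ.* (2 ℕ.* j ℕ.+ 1)) ℕ.+ 6 ℕ.* (suc j ℕ.* suc j)
    ≡⟨ cong (λ n → 6 ℕ.* r ℕ.+ n ℕ.+ 6 ℕ.* (suc j ℕ.* suc j)) (length-box D j j²≤D′) ⟩
  6 ℕ.* r ℕ.+ 3 ℕ.* ((2 ℕ.* j ℕ.+ 1) ℕ.* D) ℕ.+ 6 ℕ.* (suc j ℕ.* suc j)
    ≡⟨ cong (λ n → 6 ℕ.* r ℕ.+ 3 ℕ.* ((2 ℕ.* j ℕ.+ 1) ℕ.* n) ℕ.+ 6 ℕ.* (suc j ℕ.* suc j)) D≡ ⟩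
  6 ℕ.* r ℕ.+ 3 ℕ.* ((2 ℕ.* j ℕ.+ 1) ℕ.* (suc j ℕ.* suc j ℕ.+ r)) ℕ.+ 6 ℕ.* (suc j ℕ.* suc j)
    ≡⟨ fold r j ⟩
  3 ℕ.* ((2 ℕ.* suc j ℕ.+ 1) ℕ.* (suc j ℕ.* suc j ℕ.+ r))
    ≡⟨ cong (λ n → 3 ℕ.* ((2 ℕ.* suc j ℕ.+ 1) ℕ.* n)) (sym D≡) ⟩
  3 ℕ.* ((2 ℕ.* suc j ℕ.+ 1) ℕ.* D) ∎
  where
  open ≡-Reasoning
  r = D ∸ suc j ℕ.* suc j
  L = length (box D j)
  D≡ : D ≡ suc j ℕ.* suc j ℕ.+ r
  D≡ = sym (ℕP.m+[n∸m]≡n j²≤D)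
  j²≤D′ : j ℕ.* j ℕ.≤ D
  j²≤D′ = ℕP.≤-trans (ℕP.*-mono-≤ (ℕP.n≤1+n j) (ℕP.n≤1+n j)) j²≤D
  length-split : length (box D (suc j)) ≡ r ℕ.+ (r ℕ.+ L)
  length-split = trans (LP.length-++ (row D (+ suc j)))
    (cong₂ ℕ._+_ (length-row D (+ suc j)) (trans (LP.length-++ (row D -[1+ j ])) (cong (ℕ._+ L) (length-row D -[1+ j ]))))
  peel : ∀ r L j → 3 ℕ.* (r ℕ.+ (r ℕ.+ L)) ℕ.+ suc j ℕ.* (suc j ℕ.+ 1) ℕ.* (2 ℕ.* suc j ℕ.+ 1)
                 ≡ 6 ℕ.* r ℕ.+ (3 ℕ.* L ℕ.+ j ℕ.* (j ℕ.+ 1) ℕ.* (2 ℕ.* j ℕ.+ 1)) ℕ.+ 6 ℕ.* (suc j ℕ.* suc j)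
  peel = ℕSolver.solve-∀
  fold : ∀ r j → 6 ℕ.* r ℕ.+ 3 ℕ.* ((2 ℕ.* j ℕ.+ 1) ℕ.* (suc j ℕ.* suc j ℕ.+ r)) ℕ.+ 6 ℕ.* (suc j ℕ.* suc j)
               ≡ 3 ℕ.* ((2 ℕ.* suc j ℕ.+ 1) ℕ.* (suc j ℕ.* suc j ℕ.+ r))
  fold = ℕSolver.solve-∀

Kconst≡1+length-box : ∀ D t → t ℕ.* t ℕ.≤ D → Kconst t (+ D) ≡ + suc (length (box D t))
Kconst≡1+length-box D t t²≤D = begin
  + (2 ℕ.* t ℕ.+ 1) ℤ.* + D ℤ.+ + 1 ℤ.- + (T ℕ./ 3)
                                    ≡⟨ cong (λ n → n ℤ.+ + 1 ℤ.- + (T ℕ./ 3)) (sym (ℤP.pos-* (2 ℕ.* t ℕ.+ 1) D)) ⟩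
  + M ℤ.+ + 1 ℤ.- + (T ℕ./ 3)       ≡⟨ cong (λ n → + M ℤ.+ + 1 ℤ.- + n) T/3≡ ⟩
  + M ℤ.+ + 1 ℤ.- + (M ∸ L)         ≡⟨ cong (λ n → + M ℤ.+ + 1 ℤ.- n) (sym (trans (ℤP.m-n≡m⊖n M L) (ℤP.⊖-≥ L≤M))) ⟩
  + M ℤ.+ + 1 ℤ.- (+ M ℤ.- + L)     ≡⟨ cancel (+ M) (+ L) ⟩
  + 1 ℤ.+ + L                       ∎
  where
  open ≡-Reasoning
  L = length (box D t)
  M = (2 ℕ.* t ℕ.+ 1) ℕ.* D
  T = t ℕ.* (t ℕ.+ 1) ℕ.* (2 ℕ.* t ℕ.+ 1)
  T≡ : T ≡ (M ∸ L) ℕ.* 3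
  T≡ = begin
    T                        ≡⟨ sym (ℕP.m+n∸m≡n (3 ℕ.* L) T) ⟩
    (3 ℕ.* L ℕ.+ T) ∸ 3 ℕ.* L ≡⟨ cong (_∸ 3 ℕ.* L) (length-box D t t²≤D) ⟩
    3 ℕ.* M ∸ 3 ℕ.* L        ≡⟨ sym (ℕP.*-distribˡ-∸ 3 M L) ⟩
    3 ℕ.* (M ∸ L)            ≡⟨ ℕP.*-comm 3 (M ∸ L) ⟩
    (M ∸ L) ℕ.* 3            ∎
  T/3≡ : T ℕ./ 3 ≡ M ∸ L
  T/3≡ = trans (cong (ℕ._/ 3) T≡) (ℕDM.m*n/n≡m (M ∸ L) 3)
  L≤M : L ℕ.≤ M
  L≤M = ℕP.*-cancelˡ-≤ 3 (ℕP.≤-trans (ℕP.m≤m+n (3 ℕ.* L) T) (ℕP.≤-reflexive (length-box D t t²≤D)))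
  cancel : ∀ a b → a ℤ.+ + 1 ℤ.- (a ℤ.- b) ≡ + 1 ℤ.+ b
  cancel = ℤSolver.solve-∀

square-abs : ∀ P → P ℤ.* P ≡ + (ℤ.∣ P ∣ ℕ.* ℤ.∣ P ∣)
square-abs (+ zero) = refl
square-abs +[1+ n ] = refl
square-abs -[1+ n ] = refl

in-box : ∀ {D t P Q R} → D ℕ.< suc t ℕ.* suc t → + 0 ℤ.< + D ℤ.- P ℤ.* P → R ℤ.* Q ≡ + D ℤ.- P ℤ.* P →
         (P , ℤ.∣ Q ∣) ∈ box D t
in-box {D} {t} {P} {Q} {R} D<[t+1]² 0<D-P² RQ≡ = ∈-box D t P ∣P∣≤t ∣Q∣>0 ∣Q∣≤
  where
  n = ℤ.∣ P ∣ ℕ.* ℤ.∣ P ∣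
  n<D : n ℕ.< D
  n<D = ℤP.drop‿+<+ (subst₂ ℤ._<_ (ℤP.+-identityˡ (+ n)) (cancel (+ D) (+ n))
                       (ℤP.+-monoˡ-< (+ n) (subst (λ z → + 0 ℤ.< + D ℤ.- z) (square-abs P) 0<D-P²)))
    where
    cancel : ∀ a b → a ℤ.- b ℤ.+ b ≡ a
    cancel = ℤSolver.solve-∀
  ∣P∣≤t : ℤ.∣ P ∣ ℕ.≤ t
  ∣P∣≤t = ℕP.≮⇒≥ (λ t<∣P∣ → ℕP.<⇒≱ (ℕP.<-trans n<D D<[t+1]²) (ℕP.*-mono-≤ t<∣P∣ t<∣P∣))
  ∣R∣∣Q∣≡ : ℤ.∣ R ∣ ℕ.* ℤ.∣ Q ∣ ≡ D ∸ n
  ∣R∣∣Q∣≡ = trans (sym (ℤP.abs-* R Q))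
                  (cong ℤ.∣_∣ (trans RQ≡ (trans (cong (λ z → + D ℤ.- z) (square-abs P))
                                                (trans (ℤP.m-n≡m⊖n D n) (ℤP.⊖-≥ (ℕP.<⇒≤ n<D))))))
  instance
    ∣R∣∣Q∣≢0 : ℕ.NonZero (ℤ.∣ R ∣ ℕ.* ℤ.∣ Q ∣)
    ∣R∣∣Q∣≢0 = ℕ.>-nonZero (subst (0 ℕ.<_) (sym ∣R∣∣Q∣≡) (ℕP.m<n⇒0<n∸m n<D))
  ∣Q∣>0 : 0 ℕ.< ℤ.∣ Q ∣
  ∣Q∣>0 = ℕ.>-nonZero⁻¹ ℤ.∣ Q ∣ {{ℕP.m*n≢0⇒n≢0 ℤ.∣ R ∣}}
  ∣Q∣≤ : ℤ.∣ Q ∣ ℕ.≤ D ∸ n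
  ∣Q∣≤ = subst (ℤ.∣ Q ∣ ℕ.≤_) ∣R∣∣Q∣≡ (ℕP.m≤n*m ℤ.∣ Q ∣ ℤ.∣ R ∣ {{ℕP.m*n≢0⇒m≢0 ℤ.∣ R ∣}})

-- Pigeonhole and periodicity

pigeonhole-∈ : ∀ {A : Set} (xs : List A) (c : ℕ → A) → (∀ i → i ℕ.≤ length xs → c i ∈ xs) →
               Σ ℕ λ i → Σ ℕ λ j → i ℕ.< j × j ℕ.≤ length xs × c i ≡ c j
pigeonhole-∈ xs c c∈ = toℕ i , toℕ j , i<j , bounded j , same-value
  where
  bounded : (k : Fin (suc (length xs))) → toℕ k ℕ.≤ length xs
  bounded k = ℕP.≤-pred (FinP.toℕ<n k)
  position : Fin (suc (length xs)) → Fin (length xs)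
  position k = index (c∈ (toℕ k) (bounded k))
  collision = FinP.pigeonhole (ℕP.n<1+n (length xs)) position
  i = proj₁ collision
  j = proj₁ (proj₂ collision)
  i<j = proj₁ (proj₂ (proj₂ collision))
  same-value : c (toℕ i) ≡ c (toℕ j)
  same-value = trans (lookup-index (c∈ (toℕ i) (bounded i)))
                 (trans (cong (lookup xs) (proj₂ (proj₂ (proj₂ collision))))
                        (sym (lookup-index (c∈ (toℕ j) (bounded j)))))

pos-*-trans : ∀ a b c → + 0 ℤ.< a ℤ.* b → + 0 ℤ.< b ℤ.* c → + 0 ℤ.< a ℤ.* c
pos-*-trans +[1+ _ ] +[1+ _ ] +[1+ _ ] _ _ = ℤ.+<+ (ℕ.s≤s ℕ.z≤n)
pos-*-trans -[1+ _ ] -[1+ _ ] -[1+ _ ] _ _ = ℤ.+<+ (ℕ.s≤s ℕ.z≤n)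
pos-*-trans (+ zero) b c ab>0 _ = ⊥-elim (ℤP.<-irrefl (sym (ℤP.*-zeroˡ b)) ab>0)
pos-*-trans a (+ zero) c ab>0 _ = ⊥-elim (ℤP.<-irrefl (sym (ℤP.*-zeroʳ a)) ab>0)
pos-*-trans a b (+ zero) _ bc>0 = ⊥-elim (ℤP.<-irrefl (sym (ℤP.*-zeroʳ b)) bc>0)
pos-*-trans +[1+ _ ] -[1+ _ ] _ () _
pos-*-trans -[1+ _ ] +[1+ _ ] _ () _
pos-*-trans _ +[1+ _ ] -[1+ _ ] _ ()
pos-*-trans _ -[1+ _ ] +[1+ _ ] _ ()

∣i∣≡∣j∣∧same-sign⇒i≡j : ∀ s i j → ℤ.∣ i ∣ ≡ ℤ.∣ j ∣ → + 0 ℤ.< s ℤ.* i → + 0 ℤ.< s ℤ.* j → i ≡ j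
∣i∣≡∣j∣∧same-sign⇒i≡j s (+ m) (+ n) ∣i∣≡∣j∣ _ _ = cong +_ ∣i∣≡∣j∣
∣i∣≡∣j∣∧same-sign⇒i≡j s -[1+ m ] -[1+ n ] ∣i∣≡∣j∣ _ _ = cong -[1+_] (ℕP.suc-injective ∣i∣≡∣j∣)
∣i∣≡∣j∣∧same-sign⇒i≡j s (+ zero) -[1+ n ] () _ _
∣i∣≡∣j∣∧same-sign⇒i≡j s -[1+ m ] (+ zero) () _ _
∣i∣≡∣j∣∧same-sign⇒i≡j +[1+ _ ] +[1+ m ] -[1+ n ] _ _ ()
∣i∣≡∣j∣∧same-sign⇒i≡j -[1+ _ ] +[1+ m ] -[1+ n ] _ () _
∣i∣≡∣j∣∧same-sign⇒i≡j +[1+ _ ] -[1+ m ] +[1+ n ] _ () _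
∣i∣≡∣j∣∧same-sign⇒i≡j -[1+ _ ] -[1+ m ] +[1+ n ] _ _ ()
∣i∣≡∣j∣∧same-sign⇒i≡j (+ zero) +[1+ m ] -[1+ n ] _ si>0 _ = ⊥-elim (ℤP.<-irrefl refl si>0)
∣i∣≡∣j∣∧same-sign⇒i≡j (+ zero) -[1+ m ] +[1+ n ] _ si>0 _ = ⊥-elim (ℤP.<-irrefl refl si>0)

mulδ-identityʳ : ∀ Δ X → mulδ Δ X (scal 1ℚ) ≡ X
mulδ-identityʳ Δ (x , y) = cong₂ _,_
  (solve 3 (λ x y D → x :* con 1ℚ :+ D :* (y :* con 0ℚ) := x) refl x y (ι Δ))
  (solve 2 (λ x y → x :* con 0ℚ :+ y :* con 1ℚ := y) refl x y)

mulδ-swap : ∀ Δ X X′ Y → mulδ Δ X (mulδ Δ X′ Y) ≡ mulδ Δ X′ (mulδ Δ X Y)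
mulδ-swap Δ (x , y) (x′ , y′) (u , v) = cong₂ _,_
  (solve 7 (λ x y x′ y′ u v D → x :* (x′ :* u :+ D :* (y′ :* v)) :+ D :* (y :* (x′ :* v :+ y′ :* u))
                              := x′ :* (x :* u :+ D :* (y :* v)) :+ D :* (y′ :* (x :* v :+ y :* u))) refl x y x′ y′ u v (ι Δ))
  (solve 7 (λ x y x′ y′ u v D → x :* (x′ :* v :+ y′ :* u) :+ y :* (x′ :* u :+ D :* (y′ :* v))
                              := x′ :* (x :* v :+ y :* u) :+ y′ :* (x :* u :+ D :* (y :* v))) refl x y x′ y′ u v (ι Δ))

mulδ-inverse-unique : ∀ Δ X X′ Y → mulδ Δ X Y ≡ scal 1ℚ → mulδ Δ X′ Y ≡ scal 1ℚ → X ≡ X′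
mulδ-inverse-unique Δ X X′ Y XY≡1 X′Y≡1 = begin
  X                         ≡⟨ sym (mulδ-identityʳ Δ X) ⟩
  mulδ Δ X (scal 1ℚ)         ≡⟨ cong (mulδ Δ X) (sym X′Y≡1) ⟩
  mulδ Δ X (mulδ Δ X′ Y)     ≡⟨ mulδ-swap Δ X X′ Y ⟩
  mulδ Δ X′ (mulδ Δ X Y)     ≡⟨ cong (mulδ Δ X′) XY≡1 ⟩
  mulδ Δ X′ (scal 1ℚ)        ≡⟨ mulδ-identityʳ Δ X′ ⟩
  X′                        ∎
  where open ≡-Reasoning

module Expansion {p : ℕ} (pp : Prime p) {D : ℕ} {d : ℕ → ℤ} (H : IsPAdicSqrt p (+ D) d)
                 (nonsquare : ∀ z → z ℤ.* z ≢ + D) {α : ℕ → Qδ} {a : ℕ → ℚ}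
                 (s-spec : ∀ n → IsS p d (α n) (a n))
                 (inv : ∀ n → mulδ (+ D) (α (suc n)) (α n ⊖ scal (a n)) ≡ scal 1ℚ) where

  open PAdic pp {+ D} {d} H
  open Step pp {+ D} {d} H nonsquare

  a-cong : ∀ {m n} → α m ≡ α n → a m ≡ a n
  a-cong {m} {n} αm≡αn = s-unique {α m} {a m} {a n} (s-spec m) (subst (λ γ → IsS p d γ (a n)) (sym αm≡αn) (s-spec n))

  α-shift : ∀ {S T} → α S ≡ α T → ∀ k → α (k ℕ.+ S) ≡ α (k ℕ.+ T)
  α-shift αS≡αT zero = αS≡αT
  α-shift {S} {T} αS≡αT (suc k) =
    mulδ-inverse-unique (+ D) (α (suc (k ℕ.+ S))) (α (suc (k ℕ.+ T))) (α (k ℕ.+ S) ⊖ scal (a (k ℕ.+ S))) (inv (k ℕ.+ S))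
      (subst₂ (λ γ c → mulδ (+ D) (α (suc (k ℕ.+ T))) (γ ⊖ scal c) ≡ scal 1ℚ)
              (sym (α-shift αS≡αT k)) (sym (a-cong (α-shift αS≡αT k))) (inv (k ℕ.+ T)))

  periodic-from-repeat : ∀ {S T} → S ℕ.≤ T → α S ≡ α T → ∀ m → S ℕ.≤ m → a (m ℕ.+ (T ∸ S)) ≡ a m
  periodic-from-repeat {S} {T} S≤T αS≡αT m S≤m = begin
    a (m ℕ.+ (T ∸ S))       ≡⟨ cong a m+[T∸S]≡ ⟩
    a ((m ∸ S) ℕ.+ T)       ≡⟨ sym (a-cong (α-shift αS≡αT (m ∸ S))) ⟩
    a ((m ∸ S) ℕ.+ S)       ≡⟨ cong a (ℕP.m∸n+n≡m S≤m) ⟩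
    a m                     ∎
    where
    open ≡-Reasoning
    m+[T∸S]≡ : m ℕ.+ (T ∸ S) ≡ (m ∸ S) ℕ.+ T
    m+[T∸S]≡ = begin
      m ℕ.+ (T ∸ S)               ≡⟨ cong (ℕ._+ (T ∸ S)) (sym (ℕP.m∸n+n≡m S≤m)) ⟩
      (m ∸ S) ℕ.+ S ℕ.+ (T ∸ S)   ≡⟨ ℕP.+-assoc (m ∸ S) S (T ∸ S) ⟩
      (m ∸ S) ℕ.+ (S ℕ.+ (T ∸ S)) ≡⟨ cong ((m ∸ S) ℕ.+_) (ℕP.m+[n∸m]≡n S≤T) ⟩
      (m ∸ S) ℕ.+ T               ∎

  module Denominators (F₁ : AdmissibleForm (α 1)) where

    forms : ∀ n → AdmissibleForm (α (suc n))
    forms zero = F₁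
    forms (suc n) = proj₁ (next-admissible (forms n) (s-spec (suc n)) (inv (suc n)))

    P Q : ℕ → ℤ
    P n = AdmissibleForm.P (forms n)
    Q n = AdmissibleForm.Q (forms n)

    consecutive : ∀ n → Q n ℤ.* Q (suc n) ≡ + D ℤ.- P (suc n) ℤ.* P (suc n)
    consecutive n = proj₂ (next-admissible (forms n) (s-spec (suc n)) (inv (suc n)))

    -- The norm condition at αₙ involves Qₙ₋₁, so the window of K quotients starts at α(n₀ + 1).
    module Window (t : ℕ) (t²≤D : t ℕ.* t ℕ.≤ D) (D<[t+1]² : D ℕ.< suc t ℕ.* suc t) (n₁ : ℕ)
                  (norm<0 : ∀ n → suc n₁ ℕ.≤ n → + n ℤ.≤ + suc n₁ ℤ.+ Kconst t (+ D) → normδ (+ D) (α n) ℚ.< 0ℚ) where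

      L = length (box D t)
      K≡ : Kconst t (+ D) ≡ + suc L
      K≡ = Kconst≡1+length-box D t t²≤D
      norm<0-in-window : ∀ i → i ℕ.≤ L → normδ (+ D) (α (suc (suc (i ℕ.+ n₁)))) ℚ.< 0ℚ
      norm<0-in-window i i≤L = norm<0 (suc (suc (i ℕ.+ n₁))) (ℕ.s≤s (ℕP.≤-trans (ℕP.m≤n+m n₁ i) (ℕP.n≤1+n _)))
        (subst (+ suc (suc (i ℕ.+ n₁)) ℤ.≤_) (cong (λ k → + suc n₁ ℤ.+ k) (sym K≡))
           (ℤ.+≤+ (ℕ.s≤s (subst (suc (i ℕ.+ n₁) ℕ.≤_) (ℕP.+-comm (suc L) n₁) (ℕ.s≤s (ℕP.+-monoˡ-≤ n₁ i≤L))))))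
      P²<D : ∀ i → i ℕ.≤ L → + 0 ℤ.< + D ℤ.- P (suc (i ℕ.+ n₁)) ℤ.* P (suc (i ℕ.+ n₁))
      P²<D i i≤L = normδ<0⇒P²<Δ {+ D} (AdmissibleForm.form (forms (suc (i ℕ.+ n₁)))) (norm<0-in-window i i≤L)
      positive : ∀ i → i ℕ.≤ L → + 0 ℤ.< Q (i ℕ.+ n₁) ℤ.* Q (suc (i ℕ.+ n₁))
      positive i i≤L = subst (+ 0 ℤ.<_) (sym (consecutive (i ℕ.+ n₁))) (P²<D i i≤L)
      same-sign : ∀ i → i ℕ.≤ L → + 0 ℤ.< Q n₁ ℤ.* Q (suc (i ℕ.+ n₁))
      same-sign zero 0≤L = positive 0 0≤L
      same-sign (suc i) i<L = pos-*-trans (Q n₁) (Q (suc (i ℕ.+ n₁))) (Q (suc (suc i ℕ.+ n₁)))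
                                (same-sign i (ℕP.≤-trans (ℕP.n≤1+n i) i<L)) (positive (suc i) i<L)
      code : ℕ → ℤ × ℕ
      code i = P (suc (i ℕ.+ n₁)) , ℤ.∣ Q (suc (i ℕ.+ n₁)) ∣
      code∈box : ∀ i → i ℕ.≤ L → code i ∈ box D t
      code∈box i i≤L = in-box {D} {t} {Q = Q (suc (i ℕ.+ n₁))} {R = Q (i ℕ.+ n₁)} D<[t+1]² (P²<D i i≤L) (consecutive (i ℕ.+ n₁))
      repeat : Σ ℕ λ S → Σ ℕ λ T → S ℕ.< T × + (T ∸ S) ℤ.≤ Kconst t (+ D) × α S ≡ α T
      repeat = suc (suc (i ℕ.+ n₁)) , suc (suc (j ℕ.+ n₁)) , ℕ.s≤s (ℕ.s≤s (ℕP.+-monoˡ-< n₁ i<j)) , period≤K , α≡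
        where
        collision = pigeonhole-∈ (box D t) code code∈box
        i = proj₁ collision
        j = proj₁ (proj₂ collision)
        i<j = proj₁ (proj₂ (proj₂ collision))
        j≤L = proj₁ (proj₂ (proj₂ (proj₂ collision)))
        same-code = proj₂ (proj₂ (proj₂ (proj₂ collision)))
        Q≡ : Q (suc (i ℕ.+ n₁)) ≡ Q (suc (j ℕ.+ n₁))
        Q≡ = ∣i∣≡∣j∣∧same-sign⇒i≡j (Q n₁) _ _ (cong proj₂ same-code)
               (same-sign i (ℕP.≤-trans (ℕP.<⇒≤ i<j) j≤L)) (same-sign j j≤L)
        α≡ : α (suc (suc (i ℕ.+ n₁))) ≡ α (suc (suc (j ℕ.+ n₁)))
        α≡ = HasForm-injective (AdmissibleForm.form (forms (suc (i ℕ.+ n₁))))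
               (subst₂ (HasForm (α (suc (suc (j ℕ.+ n₁))))) (sym (cong proj₁ same-code)) (sym Q≡)
                       (AdmissibleForm.form (forms (suc (j ℕ.+ n₁)))))
        period≤K : + (suc (suc (j ℕ.+ n₁)) ∸ suc (suc (i ℕ.+ n₁))) ℤ.≤ Kconst t (+ D)
        period≤K = subst (+ (j ℕ.+ n₁ ∸ (i ℕ.+ n₁)) ℤ.≤_) (sym K≡) (ℤ.+≤+ (ℕP.≤-trans (ℕP.≤-trans (ℕP.∸-monoʳ-≤ (j ℕ.+ n₁) (ℕP.m≤n+m n₁ i))
                                                               (ℕP.≤-reflexive (ℕP.m+n∸n≡m j n₁)))
                                                    (ℕP.≤-trans j≤L (ℕP.n≤1+n L))))

    repeat-in-window : ∀ t → t ℕ.* t ℕ.≤ D → D ℕ.< suc t ℕ.* suc t → ∀ n₀ → 0 ℕ.< n₀ →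
      (∀ n → n₀ ℕ.≤ n → + n ℤ.≤ + n₀ ℤ.+ Kconst t (+ D) → normδ (+ D) (α n) ℚ.< 0ℚ) →
      Σ ℕ λ S → Σ ℕ λ T → S ℕ.< T × + (T ∸ S) ℤ.≤ Kconst t (+ D) × α S ≡ α T
    repeat-in-window t t²≤D D<[t+1]² (suc n₁) _ norm<0 = Window.repeat t t²≤D D<[t+1]² n₁ norm<0

proposition4p8 :
    (p : ℕ) → Prime p → 2 ℕ.< p →
    (Δ : ℤ) → (∀ z → z ℤ.* z ≢ Δ) → ℤ.0ℤ ℤ.< Δ →
    (d : ℕ → ℤ) → IsPAdicSqrt p Δ d →
    (b₀ c₀ k₀ : ℤ) → ¬ ((+ p) ∣ℤ c₀) → c₀ ∣ℤ (Δ ℤ.- b₀ ℤ.* b₀) →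
    (α₀ : Qδ) → IsAlphaForm p Δ α₀ b₀ c₀ k₀ →
    (α : ℕ → Qδ) → (a : ℕ → ℚ) → IsBrowkin p Δ d α₀ α a →
    (t : ℕ) → + (t ℕ.* t) ℤ.≤ Δ → Δ ℤ.< + (suc t ℕ.* suc t) →
    (n₀ : ℕ) → 0 ℕ.< n₀ →
    (∀ n → n₀ ℕ.≤ n → + n ℤ.≤ + n₀ ℤ.+ Kconst t Δ → normδ Δ (α n) ℚ.< 0ℚ) →
    Σ ℕ λ M₀ → Σ ℕ λ h → (0 ℕ.< h) × (+ h ℤ.≤ Kconst t Δ) ×
      (∀ m → M₀ ℕ.≤ m → a (m ℕ.+ h) ≡ a m)
-- The argument works for every prime p.
proposition4p8 p pp _ (+ D) nonsquare _ d H b₀ c₀ k₀ p∤c₀ c₀∣ .(α 0) αf α a (refl , s-spec , inv)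
               t t²≤Δ Δ<[t+1]² n₀ n₀>0 norm<0
  = conclude (repeat-in-window t (ℤP.drop‿+≤+ t²≤Δ) (ℤP.drop‿+<+ Δ<[t+1]²) n₀ n₀>0 norm<0)
  where
  open Expansion pp {D} {d} H nonsquare {α} {a} s-spec inv
  open Step pp {+ D} {d} H nonsquare using (first-admissible)
  open Denominators (first-admissible p∤c₀ c₀∣ αf (s-spec 0) (inv 0))
  conclude : (Σ ℕ λ S → Σ ℕ λ T → S ℕ.< T × + (T ℕ.∸ S) ℤ.≤ Kconst t (+ D) × α S ≡ α T) →
             Σ ℕ λ M₀ → Σ ℕ λ h → (0 ℕ.< h) × (+ h ℤ.≤ Kconst t (+ D)) × (∀ m → M₀ ℕ.≤ m → a (m ℕ.+ h) ≡ a m)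
  conclude (S , T , S<T , T∸S≤K , αS≡αT) =
    S , T ℕ.∸ S , ℕP.m<n⇒0<n∸m S<T , T∸S≤K , periodic-from-repeat (ℕP.<⇒≤ S<T) αS≡αT
proposition4p8 p pp _ -[1+ _ ] _ () d H b₀ c₀ k₀ p∤c₀ c₀∣ α₀ αf α a browkin t t²≤Δ Δ<[t+1]² n₀ n₀>0 norm<0
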